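{- Let $H$ be a weighted graph with no loops, and let $a\in V(H)$ have $\alpha(a)=\beta(a)=1$. Then for every composition $H\ast K$ (with $K$ any weighted graph such that $H\ast K$ is defined), $q(H\ast K)=q(K')$, where $K'$ is obtained from $K$ by giving $a$ the weights \[ \alpha(a)=\frac{q(H)-y\,q(H-a)}{(x-1)^{2}-(y-1)^{2}},\qquad \beta(a)=\frac{((x-1)^{2}+y-1)\,q(H-a)-(y-1)\,q(H)}{(x-1)^{2}-(y-1)^{2}}. \]
   Context: All graphs are finite and may have loops (at most one per vertex) but no multiple edges. The adjacency matrix of a graph is the symmetric $0/1$ matrix over $GF(2)$ whose diagonal entry at $v$ is $1$ iff $v$ is looped; $r(G)$, $n(G)$ are its rank and nullity over $GF(2)$ (empty graph: $r=n=0$). For $S\subseteq V(G)$, $G[S]$ is the induced subgraph. Let $A$ be a commutative ring with unity containing elements $x,y$ such that $(x-1)^2-(y-1)^2$ is invertible in $A$ (e.g. a field of rational functions in $x,y$). A weighted graph is a graph $G$ with functions $\alpha,\beta:V(G)\to A$, and \[ q(G)=\sum_{S\subseteq V(G)}\Big(\prod_{s\in S}\alpha(s)\Big)\Big(\prod_{v\notin S}\beta(v)\Big)(x-1)^{r(G[S])}(y-1)^{n(G[S])}. \] Deleting a vertex leaves the other weights unchanged. Composition: a weighted graph $G=H\ast K$ is the composition of weighted graphs $H$ and $K$ if (a) $V(H)\cap V(K)=\{a\}$ with $a$ unlooped in both $H$ and $K$; (b) $\alpha(a)=\beta(a)=1$ in both $H$ and $K$; (c) $V(G)=(V(H)\cup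 V(K))\setminus\{a\}$ and vertices of $G$ inherit their weights (and loops) from $H$ and $K$; (d) the edges of $G$ are the edges of $H-a$, the edges of $K-a$, and the edges $vw$ for all $v\in V(K)\setminus\{a\}$ adjacent to $a$ in $K$ and $w\in V(H)\setminus\{a\}$ adjacent to $a$ in $H$. -}

module Defs where

open import Algebra.Bundles using (CommutativeRing)
open import Data.Bool using (Bool; true; false; _xor_; _∧_; if_then_else_)
open import Data.Nat using (ℕ; zero; suc; _∸_) renaming (_+_ to _+ℕ_)
open import Data.Fin using (Fin; punchIn; splitAt; _≟_) renaming (zero to Fzero; suc to Fsuc)
open import Data.List using (List; []; _∷_; map; length; _++_)
open import Data.Maybe using (Maybe; just; nothing)
open import Data.Product using (_×_; _,_)
open import Data.Sum using (_⊎_; inj₁; inj₂)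
open import Relation.Nullary using (yes; no)
open import Relation.Binary.PropositionalEquality using (_≡_)

-- Rank over GF(2) (Bool with xor as addition) by Gaussian elimination.
-- A matrix is a list of rows; each row a list of Bool.

rowHead : List Bool → Bool
rowHead []      = false
rowHead (b ∷ _) = b

rowTail : List Bool → List Bool
rowTail []       = []
rowTail (_ ∷ bs) = bs

xorRow : List Bool → List Bool → List Bool
xorRow []       ys       = ys
xorRow xs       []       = xs
xorRow (a ∷ as) (b ∷ bs) = (a xor b) ∷ xorRow as bs

pivot : List (List Bool) → Maybe (List Bool × List (List Bool))
pivot [] = nothing
pivot (r ∷ rs) with rowHead r
... | true  = just (r , rs)
... | false with pivot rs
...   | nothing         = nothing
...   | just (p , rest) = just (p , r ∷ rest)

rankCols : ℕ → List (List Bool) → ℕ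
rankCols zero    rows = 0
rankCols (suc c) rows with pivot rows
... | nothing         = rankCols c (map rowTail rows)
... | just (p , rest) =
  suc (rankCols c (map (λ r → rowTail (if rowHead r then xorRow r p else r)) rest))

-- GF(2) rank of a square matrix (k rows of length k)
rank2 : List (List Bool) → ℕ
rank2 rows = rankCols (length rows) rows

-- Weighted graphs on vertex set Fin n. adj i i = true means i is looped.

record WGraph {c} (A : Set c) (n : ℕ) : Set c where
  field
    adj : Fin n → Fin n → Bool
    α   : Fin n → A
    β   : Fin n → A
open WGraph public

IsGraph : ∀ {c} {A : Set c} {n : ℕ} → WGraph A n → Set
IsGraph G = ∀ i j → adj G i j ≡ adj G j i

Loopless : ∀ {c} {A : Set c} {n : ℕ} → WGraph A n → Set
Loopless G = ∀ i → adj G i i ≡ false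

inducedMatrix : ∀ {c} {A : Set c} {n : ℕ} → WGraph A n → List (Fin n) → List (List Bool)
inducedMatrix G S = map (λ i → map (adj G i) S) S

rankInd : ∀ {c} {A : Set c} {n : ℕ} → WGraph A n → List (Fin n) → ℕ
rankInd G S = rank2 (inducedMatrix G S)

nullityInd : ∀ {c} {A : Set c} {n : ℕ} → WGraph A n → List (Fin n) → ℕ
nullityInd G S = length S ∸ rankInd G S

-- all splittings of a list into (S , complement of S): enumerates all subsets
splits : ∀ {a} {X : Set a} → List X → List (List X × List X)
splits []       = ([] , []) ∷ []
splits (v ∷ vs) =
  map (λ { (S , T) → (v ∷ S , T) }) (splits vs) ++
  map (λ { (S , T) → (S , v ∷ T) }) (splits vs)

allVertices : (n : ℕ) → List (Fin n)
allVertices zero    = []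
allVertices (suc n) = Fzero ∷ map Fsuc (allVertices n)

delete : ∀ {c} {A : Set c} {m : ℕ} → WGraph A (suc m) → Fin (suc m) → WGraph A m
delete G a = record
  { adj = λ i j → adj G (punchIn a i) (punchIn a j)
  ; α   = λ i → α G (punchIn a i)
  ; β   = λ i → β G (punchIn a i)
  }

-- composition H * K, where vertex a of H is identified with vertex b of K.
-- Vertices of H*K: Fin (m + k); the first m are V(H) - a, the last k are V(K) - b.
compose : ∀ {c} {A : Set c} {m k : ℕ} →
          WGraph A (suc m) → Fin (suc m) → WGraph A (suc k) → Fin (suc k) → WGraph A (m +ℕ k)
compose {A = A} {m = m} {k = k} H a K b = record
  { adj = λ i j → ad (splitAt m i) (splitAt m j)
  ; α   = λ i → wt (α H) (α K) (splitAt m i)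
  ; β   = λ i → wt (β H) (β K) (splitAt m i)
  }
  where
  ad : Fin m ⊎ Fin k → Fin m ⊎ Fin k → Bool
  ad (inj₁ i) (inj₁ j) = adj H (punchIn a i) (punchIn a j)
  ad (inj₂ i) (inj₂ j) = adj K (punchIn b i) (punchIn b j)
  ad (inj₁ i) (inj₂ j) = adj H (punchIn a i) a ∧ adj K b (punchIn b j)
  ad (inj₂ i) (inj₁ j) = adj K (punchIn b i) b ∧ adj H a (punchIn a j)
  wt : (Fin (suc m) → A) → (Fin (suc k) → A) → Fin m ⊎ Fin k → A
  wt f g (inj₁ i) = f (punchIn a i)
  wt f g (inj₂ i) = g (punchIn b i)

setWeights : ∀ {c} {A : Set c} {n : ℕ} → WGraph A n → Fin n → A → A → WGraph A n
setWeights {A = A} {n = n} G b wa wb = record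
  { adj = adj G
  ; α   = λ i → upd (α G) i wa
  ; β   = λ i → upd (β G) i wb
  }
  where
  upd : (Fin n → A) → Fin n → A → A
  upd f i w with i ≟ b
  ... | yes _ = w
  ... | no  _ = f i

module _ {c ℓ} (R : CommutativeRing c ℓ) where
  open CommutativeRing R

  _⊖_ : Carrier → Carrier → Carrier
  u ⊖ v = u + (- v)

  pow : Carrier → ℕ → Carrier
  pow u zero    = 1#
  pow u (suc e) = u * pow u e

  prodL : List Carrier → Carrier
  prodL []       = 1#
  prodL (u ∷ us) = u * prodL us

  sumL : List Carrier → Carrier
  sumL []       = 0#
  sumL (u ∷ us) = u + sumL us

  q : (x y : Carrier) → {n : ℕ} → WGraph Carrier n → Carrier
  q x y {n} G = sumL (map term (splits (allVertices n)))
    where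
    term : List (Fin n) × List (Fin n) → Carrier
    term (S , T) = prodL (map (α G) S) * prodL (map (β G) T)
                   * pow (x ⊖ 1#) (rankInd G S) * pow (y ⊖ 1#) (nullityInd G S)

module Submission where

-- Fix S ⊆ V(H) - a, let A be the adjacency matrix of H[S] and u the neighbourhood of a in S.
-- Over GF(2), either u lies in the column space of A, and then
--   r(H[S + a]) = r(A),  n(H[S + a]) = n(A) + 1,  and  (r, n)((H ∗ K)[S ∪ T]) = (r, n)(A) + (r, n)(K[T]);
-- or it does not, and then
--   r(H[S + a]) = r(A) + 2,  n(A) = n(H[S + a]) + 1,  and
--   r((H ∗ K)[S ∪ T]) = r(A) + r(K[T + a]),  n((H ∗ K)[S ∪ T]) = n(H[S + a]) + n(K[T + a])
-- for every T ⊆ V(K) - a.  Summing the weighted monomials of the sets S of the first kind into A₁ and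
-- those of the second kind into A₂ gives
--   q(H - a) = A₁ + (y - 1) A₂,   q(H) = y A₁ + ((x - 1)² + y - 1) A₂,   q(H ∗ K) = q(K′),
-- where K′ gives a the weights α(a) = A₂, β(a) = A₁; solving the first two equations, whose
-- determinant is (x - 1)² - (y - 1)², yields the stated weights.  The rank facts are obtained by
-- counting kernel vectors: an n-column matrix of rank r over GF(2) has 2^(n - r) of them.

open import Algebra.Bundles using (CommutativeRing; CommutativeSemiring)
open import Level using (Level)
open import Data.Bool using (Bool; false)
open import Data.Fin using (Fin; punchIn; _↑ˡ_; _↑ʳ_)
open import Data.List using (List; _∷_; map; _++_)
open import Data.List.Properties using (length-map; map-∘; map-cong; map-++)
open import Data.Nat using (ℕ; suc; _∸_) renaming (_+_ to _+ℕ_)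
open import Data.Product using (_×_; _,_; proj₁; proj₂)
open import Data.Sum using (_⊎_; inj₁; inj₂)
open import Relation.Binary.PropositionalEquality as ≡ using (_≡_)
open import Defs

module ListSum {c ℓ} (S : CommutativeSemiring c ℓ) where

  open CommutativeSemiring S
  open import Algebra.Properties.CommutativeSemigroup +-commutativeSemigroup using (interchange)
  open import Data.List using (List; []; _∷_; map; _++_)
  open import Data.Product using (_×_; _,_)
  open import Relation.Binary.PropositionalEquality as ≡ using (_≡_)
  open import Relation.Binary.Reasoning.Setoid setoid

  ∑ : ∀ {a} {X : Set a} → List X → (X → Carrier) → Carrier
  ∑ []       f = 0#
  ∑ (x ∷ xs) f = f x + ∑ xs f

  module _ {a} {X : Set a} where

    ∑-cong : ∀ (xs : List X) {f g : X → Carrier} → (∀ x → f x ≈ g x) → ∑ xs f ≈ ∑ xs g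
    ∑-cong []       f≈g = refl
    ∑-cong (x ∷ xs) f≈g = +-cong (f≈g x) (∑-cong xs f≈g)

    ∑-++ : ∀ (xs ys : List X) f → ∑ (xs ++ ys) f ≈ ∑ xs f + ∑ ys f
    ∑-++ []       ys f = sym (+-identityˡ _)
    ∑-++ (x ∷ xs) ys f = trans (+-congˡ (∑-++ xs ys f)) (sym (+-assoc _ _ _))

    ∑-+ : ∀ (xs : List X) f g → ∑ xs (λ x → f x + g x) ≈ ∑ xs f + ∑ xs g
    ∑-+ []       f g = sym (+-identityˡ _)
    ∑-+ (x ∷ xs) f g = trans (+-congˡ (∑-+ xs f g)) (interchange (f x) (g x) _ _)

    ∑-*ˡ : ∀ (xs : List X) k f → ∑ xs (λ x → k * f x) ≈ k * ∑ xs f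
    ∑-*ˡ []       k f = sym (zeroʳ k)
    ∑-*ˡ (x ∷ xs) k f = trans (+-congˡ (∑-*ˡ xs k f)) (sym (distribˡ k _ _))

    ∑-*ʳ : ∀ (xs : List X) k f → ∑ xs (λ x → f x * k) ≈ ∑ xs f * k
    ∑-*ʳ xs k f = trans (∑-cong xs (λ x → *-comm (f x) k)) (trans (∑-*ˡ xs k f) (*-comm k _))

    ∑-zero : ∀ (xs : List X) → ∑ xs (λ _ → 0#) ≈ 0#
    ∑-zero []       = refl
    ∑-zero (x ∷ xs) = trans (+-identityˡ _) (∑-zero xs)

  ∑-map : ∀ {a b} {X : Set a} {Y : Set b} (g : X → Y) (xs : List X) f → ∑ (map g xs) f ≡ ∑ xs (λ x → f (g x))
  ∑-map g []       f = ≡.refl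
  ∑-map g (x ∷ xs) f = ≡.cong (f (g x) +_) (∑-map g xs f)

  ∑-comm : ∀ {a b} {X : Set a} {Y : Set b} (xs : List X) (ys : List Y) (f : X → Y → Carrier) →
           ∑ xs (λ x → ∑ ys (f x)) ≈ ∑ ys (λ y → ∑ xs (λ x → f x y))
  ∑-comm []       ys f = sym (∑-zero ys)
  ∑-comm (x ∷ xs) ys f = trans (+-congˡ (∑-comm xs ys f)) (sym (∑-+ ys (f x) _))

  module _ {a} {V : Set a} where

    ∑-splits-∷ : ∀ (v : V) vs (f : List V × List V → Carrier) →
                 ∑ (splits (v ∷ vs)) f ≈ ∑ (splits vs) (λ { (S , T) → f (v ∷ S , T) + f (S , v ∷ T) })
    ∑-splits-∷ v vs f = begin
      ∑ (map _ (splits vs) ++ map _ (splits vs)) f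
        ≈⟨ ∑-++ (map _ (splits vs)) _ f ⟩
      ∑ (map _ (splits vs)) f + ∑ (map _ (splits vs)) f
        ≡⟨ ≡.cong₂ _+_ (∑-map _ (splits vs) f) (∑-map _ (splits vs) f) ⟩
      ∑ (splits vs) (λ { (S , T) → f (v ∷ S , T) }) + ∑ (splits vs) (λ { (S , T) → f (S , v ∷ T) })
        ≈⟨ sym (∑-+ (splits vs) _ _) ⟩
      ∑ (splits vs) (λ { (S , T) → f (v ∷ S , T) + f (S , v ∷ T) }) ∎

    ∑-splits-++ : ∀ (us vs : List V) (f : List V × List V → Carrier) →
                  ∑ (splits (us ++ vs)) f
                    ≈ ∑ (splits us) (λ { (S , T) → ∑ (splits vs) (λ { (S′ , T′) → f (S ++ S′ , T ++ T′) }) })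
    ∑-splits-++ []       vs f = sym (+-identityʳ _)
    ∑-splits-++ (u ∷ us) vs f = begin
      ∑ (splits (u ∷ us ++ vs)) f
        ≈⟨ ∑-splits-∷ u (us ++ vs) f ⟩
      ∑ (splits (us ++ vs)) (λ { (S , T) → f (u ∷ S , T) + f (S , u ∷ T) })
        ≈⟨ ∑-splits-++ us vs _ ⟩
      ∑ (splits us) (λ { (S , T) → ∑ (splits vs) (λ { (S′ , T′) → f (u ∷ S ++ S′ , T ++ T′) + f (S ++ S′ , u ∷ T ++ T′) }) })
        ≈⟨ ∑-cong (splits us) (λ _ → ∑-+ (splits vs) _ _) ⟩
      ∑ (splits us) (λ { (S , T) → ∑ (splits vs) (λ { (S′ , T′) → f (u ∷ S ++ S′ , T ++ T′) })
                                  + ∑ (splits vs) (λ { (S′ , T′) → f (S ++ S′ , u ∷ T ++ T′) }) })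
        ≈⟨ sym (∑-splits-∷ u us _) ⟩
      ∑ (splits (u ∷ us)) (λ { (S , T) → ∑ (splits vs) (λ { (S′ , T′) → f (S ++ S′ , T ++ T′) }) }) ∎

    ∑-splits-moveToFront : ∀ (us vs : List V) (v : V) (f : List V × List V → Carrier) →
      (∀ S₁ S₂ T → f (S₁ ++ v ∷ S₂ , T) ≈ f (v ∷ S₁ ++ S₂ , T)) →
      (∀ S T₁ T₂ → f (S , T₁ ++ v ∷ T₂) ≈ f (S , v ∷ T₁ ++ T₂)) →
      ∑ (splits (us ++ v ∷ vs)) f ≈ ∑ (splits (v ∷ us ++ vs)) f
    ∑-splits-moveToFront us vs v f moveˡ moveʳ = begin
      ∑ (splits (us ++ v ∷ vs)) f
        ≈⟨ ∑-splits-++ us (v ∷ vs) f ⟩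
      ∑ (splits us) (λ { (S , T) → ∑ (splits (v ∷ vs)) (λ { (S′ , T′) → f (S ++ S′ , T ++ T′) }) })
        ≈⟨ ∑-cong (splits us) (λ _ → ∑-splits-∷ v vs _) ⟩
      ∑ (splits us) (λ { (S , T) → ∑ (splits vs) (λ { (S′ , T′) → f (S ++ v ∷ S′ , T ++ T′) + f (S ++ S′ , T ++ v ∷ T′) }) })
        ≈⟨ ∑-cong (splits us) (λ _ → ∑-cong (splits vs) (λ _ → +-cong (moveˡ _ _ _) (moveʳ _ _ _))) ⟩
      ∑ (splits us) (λ { (S , T) → ∑ (splits vs) (λ { (S′ , T′) → f (v ∷ S ++ S′ , T ++ T′) + f (S ++ S′ , v ∷ T ++ T′) }) })
        ≈⟨ sym (∑-splits-++ us vs _) ⟩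
      ∑ (splits (us ++ vs)) (λ { (S , T) → f (v ∷ S , T) + f (S , v ∷ T) })
        ≈⟨ sym (∑-splits-∷ v (us ++ vs) f) ⟩
      ∑ (splits (v ∷ us ++ vs)) f ∎

module BoolVector where

  open import Data.Bool using (Bool; true; false; _xor_; _∧_)
  open import Data.Bool.Properties
    using (xor-assoc; xor-identityʳ; xor-same; ∧-comm; ∧-zeroʳ; ∧-distribʳ-xor; xor-∧-commutativeRing)
  open import Data.List using (List; []; _∷_; map; length; _++_; replicate)
  open import Data.List.Properties using (map-cong)
  open import Data.Nat using (suc)
  open import Data.Product using (_×_; _,_)
  open import Data.Nat.Properties using (suc-injective)
  open import Relation.Binary.PropositionalEquality

  open import Algebra.Properties.CommutativeSemigroup
    (CommutativeRing.+-commutativeSemigroup xor-∧-commutativeRing) using (interchange)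

  xor-interchange : ∀ x y z w → (x xor y) xor (z xor w) ≡ (x xor z) xor (y xor w)
  xor-interchange = interchange

  ∧≡true : ∀ x y → x ∧ y ≡ true → x ≡ true × y ≡ true
  ∧≡true true y eq = refl , eq

  xor-cancelʳ : ∀ x y → (x xor y) xor y ≡ x
  xor-cancelʳ x y = trans (xor-assoc x y y) (trans (cong (x xor_) (xor-same y)) (xor-identityʳ x))

  -- Inner product over GF(2); the shorter vector is padded with zeros.
  dot : List Bool → List Bool → Bool
  dot []      _       = false
  dot (_ ∷ _) []      = false
  dot (a ∷ r) (b ∷ w) = (a ∧ b) xor dot r w

  dot-[]ʳ : ∀ r → dot r [] ≡ false
  dot-[]ʳ []      = refl
  dot-[]ʳ (_ ∷ _) = refl

  dot-∷ʳ : ∀ r b w → dot r (b ∷ w) ≡ (rowHead r ∧ b) xor dot (rowTail r) w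
  dot-∷ʳ []      b w = refl
  dot-∷ʳ (_ ∷ _) b w = refl

  dot-comm : ∀ r w → dot r w ≡ dot w r
  dot-comm []      []      = refl
  dot-comm []      (_ ∷ _) = refl
  dot-comm (_ ∷ _) []      = refl
  dot-comm (a ∷ r) (b ∷ w) = cong₂ _xor_ (∧-comm a b) (dot-comm r w)

  dot-xorRowˡ : ∀ r p w → dot (xorRow r p) w ≡ dot r w xor dot p w
  dot-xorRowˡ []      p       w       = refl
  dot-xorRowˡ (a ∷ r) []      w       = sym (xor-identityʳ _)
  dot-xorRowˡ (a ∷ r) (b ∷ p) []      = refl
  dot-xorRowˡ (a ∷ r) (b ∷ p) (c ∷ w) =
    trans (cong₂ _xor_ (∧-distribʳ-xor c a b) (dot-xorRowˡ r p w))
          (xor-interchange (a ∧ c) (b ∧ c) (dot r w) (dot p w))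

  dot-xorRowʳ : ∀ r s w → dot r (xorRow s w) ≡ dot r s xor dot r w
  dot-xorRowʳ r s w =
    trans (dot-comm r _) (trans (dot-xorRowˡ s w r) (cong₂ _xor_ (dot-comm s r) (dot-comm w r)))

  rowHead-xorRow : ∀ r p → rowHead (xorRow r p) ≡ rowHead r xor rowHead p
  rowHead-xorRow []      p       = refl
  rowHead-xorRow (a ∷ r) []      = sym (xor-identityʳ a)
  rowHead-xorRow (a ∷ r) (b ∷ p) = refl

  dot-replicateʳ : ∀ r n → dot r (replicate n false) ≡ false
  dot-replicateʳ []      n       = refl
  dot-replicateʳ (_ ∷ r) 0       = refl
  dot-replicateʳ (a ∷ r) (suc n) = trans (cong (_xor dot r _) (∧-zeroʳ a)) (dot-replicateʳ r n)

  dot-replicateˡ : ∀ n w → dot (replicate n false) w ≡ false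
  dot-replicateˡ n w = trans (dot-comm _ w) (dot-replicateʳ w n)

  dot-++ : ∀ a b c d → length a ≡ length c → dot (a ++ b) (c ++ d) ≡ dot a c xor dot b d
  dot-++ []      b []      d _  = refl
  dot-++ (x ∷ a) b (y ∷ c) d eq =
    trans (cong ((x ∧ y) xor_) (dot-++ a b c d (suc-injective eq))) (sym (xor-assoc (x ∧ y) (dot a c) (dot b d)))

  module _ {a} {X : Set a} where

    dot-map-false : ∀ (L : List X) w → dot (map (λ _ → false) L) w ≡ false
    dot-map-false []      w       = refl
    dot-map-false (_ ∷ L) []      = refl
    dot-map-false (_ ∷ L) (_ ∷ w) = dot-map-false L w

    dot-map-cong : ∀ (L : List X) {g h : X → Bool} → (∀ x → g x ≡ h x) → ∀ w → dot (map g L) w ≡ dot (map h L) w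
    dot-map-cong L g≗h w = cong (λ r → dot r w) (map-cong g≗h L)

    dot-map-xor : ∀ (L : List X) g h w →
                  dot (map (λ x → g x xor h x) L) w ≡ dot (map g L) w xor dot (map h L) w
    dot-map-xor []      g h w       = refl
    dot-map-xor (x ∷ L) g h []      = refl
    dot-map-xor (x ∷ L) g h (b ∷ w) =
      trans (cong₂ _xor_ (∧-distribʳ-xor b (g x) (h x)) (dot-map-xor L g h w))
            (xor-interchange (g x ∧ b) (h x ∧ b) _ _)

    dot-map-∧ʳ : ∀ (L : List X) g c w → dot (map (λ x → g x ∧ c) L) w ≡ dot (map g L) w ∧ c
    dot-map-∧ʳ []      g c w       = refl
    dot-map-∧ʳ (x ∷ L) g c []      = refl
    dot-map-∧ʳ (x ∷ L) g c (b ∷ w) =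
      trans (cong₂ _xor_ (swap (g x) c b) (dot-map-∧ʳ L g c w))
            (sym (∧-distribʳ-xor c (g x ∧ b) (dot (map g L) w)))
      where
      swap : ∀ x c b → (x ∧ c) ∧ b ≡ (x ∧ b) ∧ c
      swap true  c b = ∧-comm c b
      swap false c b = refl

    dot-map-∧ˡ : ∀ (L : List X) c g w → dot (map (λ x → c ∧ g x) L) w ≡ c ∧ dot (map g L) w
    dot-map-∧ˡ L c g w =
      trans (dot-map-cong L (λ x → ∧-comm c (g x)) w) (trans (dot-map-∧ʳ L g c w) (∧-comm _ c))

  module _ {a} {I : Set a} where

    Symmetric : (I → I → Bool) → Set a
    Symmetric f = ∀ i j → f i j ≡ f j i

    ZeroDiagonal : (I → I → Bool) → Set a
    ZeroDiagonal f = ∀ i → f i i ≡ false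

    mulVec : (I → I → Bool) → List I → List I → List Bool → List Bool
    mulVec f S S′ s = map (λ i → dot (map (f i) S′) s) S

    dot-mulVec-sym : ∀ f → Symmetric f → ∀ S S′ s t → dot (mulVec f S S′ s) t ≡ dot (mulVec f S′ S t) s
    dot-mulVec-sym f f-sym []      S′ s []       = sym (dot-map-false S′ s)
    dot-mulVec-sym f f-sym []      S′ s (_ ∷ _)  = sym (dot-map-false S′ s)
    dot-mulVec-sym f f-sym (i ∷ S) S′ s []       =
      sym (trans (dot-map-cong S′ (λ j → dot-[]ʳ (f j i ∷ map (f j) S)) s) (dot-map-false S′ s))
    dot-mulVec-sym f f-sym (i ∷ S) S′ s (t₀ ∷ t) = sym (begin
        dot (map (λ j → (f j i ∧ t₀) xor dot (map (f j) S) t) S′) s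
      ≡⟨ dot-map-xor S′ (λ j → f j i ∧ t₀) (λ j → dot (map (f j) S) t) s ⟩
        dot (map (λ j → f j i ∧ t₀) S′) s xor dot (mulVec f S′ S t) s
      ≡⟨ cong₂ _xor_ (trans (dot-map-∧ʳ S′ (λ j → f j i) t₀ s) (cong (_∧ t₀) (dot-map-cong S′ (λ j → f-sym j i) s)))
                     (sym (dot-mulVec-sym f f-sym S S′ s t)) ⟩
        (dot (map (f i) S′) s ∧ t₀) xor dot (mulVec f S S′ s) t
      ∎)
      where open ≡-Reasoning

    -- A symmetric form with zero diagonal is alternating over GF(2): the off-diagonal terms cancel in pairs.
    dot-mulVec-self : ∀ f → Symmetric f → ZeroDiagonal f → ∀ S s → dot (mulVec f S S s) s ≡ false
    dot-mulVec-self f f-sym f-diag []      s        = refl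
    dot-mulVec-self f f-sym f-diag (i ∷ S) []       = refl
    dot-mulVec-self f f-sym f-diag (i ∷ S) (s₀ ∷ s) = begin
        (((f i i ∧ s₀) xor D) ∧ s₀) xor dot (map (λ j → (f j i ∧ s₀) xor dot (map (f j) S) s) S) s
      ≡⟨ cong₂ _xor_ (cong (λ z → ((z ∧ s₀) xor D) ∧ s₀) (f-diag i))
                     (dot-map-xor S (λ j → f j i ∧ s₀) (λ j → dot (map (f j) S) s) s) ⟩
        (D ∧ s₀) xor (dot (map (λ j → f j i ∧ s₀) S) s xor dot (mulVec f S S s) s)
      ≡⟨ cong (λ z → (D ∧ s₀) xor (z xor dot (mulVec f S S s) s))
          (trans (dot-map-∧ʳ S (λ j → f j i) s₀ s) (cong (_∧ s₀) (dot-map-cong S (λ j → f-sym j i) s))) ⟩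
        (D ∧ s₀) xor ((D ∧ s₀) xor dot (mulVec f S S s) s)
      ≡⟨ cong (λ z → (D ∧ s₀) xor ((D ∧ s₀) xor z)) (dot-mulVec-self f f-sym f-diag S s) ⟩
        (D ∧ s₀) xor ((D ∧ s₀) xor false)
      ≡⟨ cong ((D ∧ s₀) xor_) (xor-identityʳ _) ⟩
        (D ∧ s₀) xor (D ∧ s₀)
      ≡⟨ xor-same (D ∧ s₀) ⟩
        false
      ∎
      where
      open ≡-Reasoning
      D = dot (map (f i) S) s

module BooleanCube where

  open import Data.Bool using (Bool; true; false; _xor_; _∧_; not)
  open import Data.Bool.Properties using (∧-zeroʳ; xor-identityʳ; ∧-identityʳ)
  open import Data.Bool.ListAction using (all)
  open import Data.List using (List; []; _∷_; map; length; _++_; replicate; take; drop)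
  open import Data.List.Properties using (length-replicate)
  open import Data.Nat using (ℕ; zero; suc; _+_)
  open import Data.Nat.Properties using (+-comm; +-identityʳ; +-commutativeSemigroup; +-*-commutativeSemiring; suc-injective)
  open import Data.Product using (Σ-syntax; _×_; _,_)
  open import Data.Sum using (_⊎_; inj₁; inj₂)
  open import Algebra.Properties.CommutativeSemigroup +-commutativeSemigroup using (interchange)
  open import Relation.Binary.PropositionalEquality hiding ([_])
  open BoolVector using (dot; dot-replicateʳ)
  open ListSum +-*-commutativeSemiring

  [_] : Bool → ℕ
  [ true  ] = 1
  [ false ] = 0

  vectors : ℕ → List (List Bool)
  vectors zero    = [] ∷ []
  vectors (suc c) = map (false ∷_) (vectors c) ++ map (true ∷_) (vectors c)

  ∑𝔹 : ℕ → (List Bool → ℕ) → ℕ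
  ∑𝔹 c F = ∑ (vectors c) F

  ∑𝔹-suc : ∀ c F → ∑𝔹 (suc c) F ≡ ∑𝔹 c (λ w → F (false ∷ w)) + ∑𝔹 c (λ w → F (true ∷ w))
  ∑𝔹-suc c F = trans (∑-++ (map (false ∷_) (vectors c)) _ F)
                     (cong₂ _+_ (∑-map (false ∷_) (vectors c) F) (∑-map (true ∷_) (vectors c) F))

  ∑𝔹-cong : ∀ c {F G : List Bool → ℕ} → (∀ w → length w ≡ c → F w ≡ G w) → ∑𝔹 c F ≡ ∑𝔹 c G
  ∑𝔹-cong zero    F≗G = cong (_+ 0) (F≗G [] refl)
  ∑𝔹-cong (suc c) {F} {G} F≗G = begin
    ∑𝔹 (suc c) F                                                 ≡⟨ ∑𝔹-suc c F ⟩
    ∑𝔹 c (λ w → F (false ∷ w)) + ∑𝔹 c (λ w → F (true ∷ w))      ≡⟨ cong₂ _+_ (∑𝔹-cong c (λ w l → F≗G (false ∷ w) (cong suc l)))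
                                                                               (∑𝔹-cong c (λ w l → F≗G (true ∷ w) (cong suc l))) ⟩
    ∑𝔹 c (λ w → G (false ∷ w)) + ∑𝔹 c (λ w → G (true ∷ w))      ≡⟨ ∑𝔹-suc c G ⟨
    ∑𝔹 (suc c) G                                                 ∎
    where open ≡-Reasoning

  ∑𝔹-translate : ∀ c F z → length z ≡ c → ∑𝔹 c (λ w → F (xorRow w z)) ≡ ∑𝔹 c F
  ∑𝔹-translate zero    F []       _ = refl
  ∑𝔹-translate (suc c) F (z₀ ∷ z) l =
    trans (∑𝔹-suc c _) (trans (flip z₀) (sym (∑𝔹-suc c F)))
    where
    shift : ∀ b → ∑𝔹 c (λ w → F (b ∷ xorRow w z)) ≡ ∑𝔹 c (λ w → F (b ∷ w))
    shift b = ∑𝔹-translate c (λ w → F (b ∷ w)) z (suc-injective l)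
    flip : ∀ z₀ → ∑𝔹 c (λ w → F ((false xor z₀) ∷ xorRow w z)) + ∑𝔹 c (λ w → F ((true xor z₀) ∷ xorRow w z))
                ≡ ∑𝔹 c (λ w → F (false ∷ w)) + ∑𝔹 c (λ w → F (true ∷ w))
    flip false = cong₂ _+_ (shift false) (shift true)
    flip true  = trans (cong₂ _+_ (shift true) (shift false)) (+-comm (∑𝔹 c (λ w → F (true ∷ w))) _)

  ∑𝔹-++ : ∀ c d F → ∑𝔹 (c + d) F ≡ ∑𝔹 c (λ s → ∑𝔹 d (λ t → F (s ++ t)))
  ∑𝔹-++ zero    d F = sym (+-identityʳ _)
  ∑𝔹-++ (suc c) d F =
    trans (∑𝔹-suc (c + d) F)
          (trans (cong₂ _+_ (∑𝔹-++ c d (λ w → F (false ∷ w))) (∑𝔹-++ c d (λ w → F (true ∷ w))))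
                 (sym (∑𝔹-suc c _)))

  insertHead : ℕ → List Bool → List Bool
  insertHead p []      = []
  insertHead p (b ∷ w) = take p w ++ b ∷ drop p w

  ∑𝔹-insertHead : ∀ p d F → ∑𝔹 (p + suc d) F ≡ ∑𝔹 (suc (p + d)) (λ w → F (insertHead p w))
  ∑𝔹-insertHead zero    d F = trans (∑𝔹-suc d F) (sym (∑𝔹-suc d _))
  ∑𝔹-insertHead (suc p) d F = begin
      ∑𝔹 (suc (p + suc d)) F
    ≡⟨ ∑𝔹-suc (p + suc d) F ⟩
      ∑𝔹 (p + suc d) (λ w → F (false ∷ w)) + ∑𝔹 (p + suc d) (λ w → F (true ∷ w))
    ≡⟨ cong₂ _+_ (∑𝔹-insertHead p d (λ w → F (false ∷ w))) (∑𝔹-insertHead p d (λ w → F (true ∷ w))) ⟩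
      ∑𝔹 (suc (p + d)) (λ w → F (false ∷ insertHead p w)) + ∑𝔹 (suc (p + d)) (λ w → F (true ∷ insertHead p w))
    ≡⟨ cong₂ _+_ (∑𝔹-suc (p + d) _) (∑𝔹-suc (p + d) _) ⟩
      (part false false + part false true) + (part true false + part true true)
    ≡⟨ interchange (part false false) (part false true) (part true false) (part true true) ⟩
      (part false false + part true false) + (part false true + part true true)
    ≡⟨ cong₂ _+_ (∑𝔹-suc (p + d) _) (∑𝔹-suc (p + d) _) ⟨
      ∑𝔹 (suc (p + d)) (λ w → F (insertHead (suc p) (false ∷ w))) + ∑𝔹 (suc (p + d)) (λ w → F (insertHead (suc p) (true ∷ w)))
    ≡⟨ ∑𝔹-suc (suc (p + d)) _ ⟨
      ∑𝔹 (suc (suc p + d)) (λ w → F (insertHead (suc p) w))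
    ∎
    where
    open ≡-Reasoning
    part : Bool → Bool → ℕ
    part b b′ = ∑𝔹 (p + d) (λ w → F (b ∷ insertHead p (b′ ∷ w)))

  search𝔹 : ∀ c (P : List Bool → Bool) →
            (Σ[ w ∈ List Bool ] length w ≡ c × P w ≡ true) ⊎ (∀ w → length w ≡ c → P w ≡ false)
  search𝔹 zero P with P [] in eq
  ... | true  = inj₁ ([] , refl , eq)
  ... | false = inj₂ λ { [] _ → eq }
  search𝔹 (suc c) P with search𝔹 c (λ w → P (false ∷ w)) | search𝔹 c (λ w → P (true ∷ w))
  ... | inj₁ (w , l , eq) | _                 = inj₁ (false ∷ w , cong suc l , eq)
  ... | inj₂ _            | inj₁ (w , l , eq) = inj₁ (true ∷ w , cong suc l , eq)
  ... | inj₂ none₀        | inj₂ none₁        =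
    inj₂ λ { (false ∷ w) l → none₀ w (suc-injective l) ; (true ∷ w) l → none₁ w (suc-injective l) }

  orthogonal-to-all⇒zero : ∀ {a} {I : Set a} (S : List I) (g : I → Bool) →
    (∀ w → length w ≡ length S → dot (map g S) w ≡ false) → all (λ i → not (g i)) S ≡ true
  orthogonal-to-all⇒zero []      g ⊥w = refl
  orthogonal-to-all⇒zero (i ∷ S) g ⊥w = cong₂ _∧_ (cong not gi≡false) (orthogonal-to-all⇒zero S g ⊥w′)
    where
    gi≡false : g i ≡ false
    gi≡false = trans (sym (trans (cong₂ _xor_ (∧-identityʳ (g i)) (dot-replicateʳ (map g S) (length S))) (xor-identityʳ (g i))))
                     (⊥w (true ∷ replicate (length S) false) (cong suc (length-replicate (length S))))
    ⊥w′ : ∀ w → length w ≡ length S → dot (map g S) w ≡ false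
    ⊥w′ w l = trans (cong (_xor dot (map g S) w) (sym (∧-zeroʳ (g i)))) (⊥w (false ∷ w) (cong suc l))

module KernelCount where

  open import Data.Bool using (Bool; true; false; _xor_; _∧_; not; if_then_else_)
  open import Data.Bool.Properties using (xor-identityʳ; ∧-assoc; ∧-comm)
  open import Data.List using (List; []; _∷_; map; length)
  open import Data.Maybe using (just; nothing)
  open import Data.Nat using (ℕ; zero; suc; _+_; _*_; _∸_; _^_; _≤_; z≤n; s≤s)
  open import Data.Nat.Properties
    using (+-identityʳ; ≤-trans; n≤1+n; +-∸-assoc; m+[n∸m]≡n; *-cancelˡ-≡; +-cancelʳ-≡; m^n≡1⇒n≡0∨m≡1; +-*-commutativeSemiring)
  open import Data.Product using (_×_; _,_; proj₁; proj₂)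
  open import Data.Sum using (inj₁; inj₂)
  open import Relation.Binary.PropositionalEquality hiding ([_])
  open BoolVector using (dot; dot-[]ʳ; dot-∷ʳ; dot-xorRowˡ; rowHead-xorRow)
  open BooleanCube using ([_]; vectors; ∑𝔹; ∑𝔹-suc; ∑𝔹-cong)
  open ListSum +-*-commutativeSemiring using (∑-+)

  inKernel : List (List Bool) → List Bool → Bool
  inKernel []       w = true
  inKernel (r ∷ rs) w = not (dot r w) ∧ inKernel rs w

  kernelSize : ℕ → List (List Bool) → ℕ
  kernelSize c rows = ∑𝔹 c (λ w → [ inKernel rows w ])

  inKernel-[] : ∀ rows → inKernel rows [] ≡ true
  inKernel-[] []         = refl
  inKernel-[] (r ∷ rows) = trans (cong (λ b → not b ∧ inKernel rows []) (dot-[]ʳ r)) (inKernel-[] rows)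

  inKernel-noPivot : ∀ rows → pivot rows ≡ nothing → ∀ b w → inKernel rows (b ∷ w) ≡ inKernel (map rowTail rows) w
  inKernel-noPivot []         _  b w = refl
  inKernel-noPivot (r ∷ rows) eq b w with rowHead r in head≡
  inKernel-noPivot (r ∷ rows) () b w | true
  ... | false with pivot rows in eq′
  inKernel-noPivot (r ∷ rows) eq b w | false | nothing rewrite dot-∷ʳ r b w | head≡ =
    cong (not (dot (rowTail r) w) ∧_) (inKernel-noPivot rows eq′ b w)
  inKernel-noPivot (r ∷ rows) () b w | false | just _

  pivot-just : ∀ rows p rest → pivot rows ≡ just (p , rest) →
               rowHead p ≡ true × (∀ w → inKernel rows w ≡ inKernel (p ∷ rest) w)
  pivot-just []         p rest ()
  pivot-just (r ∷ rows) p rest eq with rowHead r in head≡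
  pivot-just (r ∷ rows) .r .rows refl | true = head≡ , λ w → refl
  ... | false with pivot rows in eq′
  pivot-just (r ∷ rows) p rest () | false | nothing
  pivot-just (r ∷ rows) .p .(r ∷ rest′) refl | false | just (p , rest′) =
    proj₁ ih , λ w → trans (cong (not (dot r w) ∧_) (proj₂ ih w)) (swap (not (dot r w)) (not (dot p w)) _)
    where
    ih = pivot-just rows p rest′ eq′
    swap : ∀ a b c → a ∧ (b ∧ c) ≡ b ∧ (a ∧ c)
    swap a b c = trans (sym (∧-assoc a b c)) (trans (cong (_∧ c) (∧-comm a b)) (∧-assoc b a c))

  eliminate : List Bool → List Bool → List Bool
  eliminate p r = if rowHead r then xorRow r p else r

  rowHead-eliminate : ∀ p r → rowHead p ≡ true → rowHead (eliminate p r) ≡ false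
  rowHead-eliminate p r head-p with rowHead r in head-r
  ... | true  rewrite rowHead-xorRow r p | head-r | head-p = refl
  ... | false = head-r

  dot-eliminate : ∀ p r w → dot p w ≡ false → dot (eliminate p r) w ≡ dot r w
  dot-eliminate p r w p⊥w with rowHead r
  ... | true  rewrite dot-xorRowˡ r p w | p⊥w = xor-identityʳ _
  ... | false = refl

  inKernel-eliminate : ∀ p rest w → dot p w ≡ false → inKernel (map (eliminate p) rest) w ≡ inKernel rest w
  inKernel-eliminate p []         w p⊥w = refl
  inKernel-eliminate p (r ∷ rest) w p⊥w rewrite dot-eliminate p r w p⊥w =
    cong (not (dot r w) ∧_) (inKernel-eliminate p rest w p⊥w)

  inKernel-eliminate-∷ : ∀ p rest b w → rowHead p ≡ true →
    inKernel (map (eliminate p) rest) (b ∷ w) ≡ inKernel (map (λ r → rowTail (eliminate p r)) rest) w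
  inKernel-eliminate-∷ p []         b w head-p = refl
  inKernel-eliminate-∷ p (r ∷ rest) b w head-p rewrite dot-∷ʳ (eliminate p r) b w | rowHead-eliminate p r head-p =
    cong (not (dot (rowTail (eliminate p r)) w) ∧_) (inKernel-eliminate-∷ p rest b w head-p)

  rankCols≤ : ∀ c rows → rankCols c rows ≤ c
  rankCols≤ zero    rows = z≤n
  rankCols≤ (suc c) rows with pivot rows
  ... | nothing       = ≤-trans (rankCols≤ c (map rowTail rows)) (n≤1+n c)
  ... | just (p , _)  = s≤s (rankCols≤ c _)

  -- Without a pivot the first coordinate of a kernel vector is free.
  kernelSize-noPivot : ∀ c rows → pivot rows ≡ nothing → kernelSize (suc c) rows ≡ 2 * kernelSize c (map rowTail rows)
  kernelSize-noPivot c rows eq = begin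
      kernelSize (suc c) rows
    ≡⟨ ∑𝔹-suc c _ ⟩
      ∑𝔹 c (λ w → [ inKernel rows (false ∷ w) ]) + ∑𝔹 c (λ w → [ inKernel rows (true ∷ w) ])
    ≡⟨ cong₂ _+_ (drop-head false) (trans (drop-head true) (sym (+-identityʳ _))) ⟩
      2 * kernelSize c (map rowTail rows)
    ∎
    where
    open ≡-Reasoning
    drop-head : ∀ b → ∑𝔹 c (λ w → [ inKernel rows (b ∷ w) ]) ≡ kernelSize c (map rowTail rows)
    drop-head b = ∑𝔹-cong c (λ w _ → cong [_] (inKernel-noPivot rows eq b w))

  -- With pivot row p, the first coordinate of a kernel vector is determined by the others,
  -- and the remaining rows may be reduced against p.
  kernelSize-pivot : ∀ c rows p rest → pivot rows ≡ just (p , rest) →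
                     kernelSize (suc c) rows ≡ kernelSize c (map (λ r → rowTail (eliminate p r)) rest)
  kernelSize-pivot c rows p rest eq =
    trans (∑𝔹-suc c _) (trans (sym (∑-+ (vectors c) _ _)) (∑𝔹-cong c (λ w _ → pair w)))
    where
    rows′ = map (λ r → rowTail (eliminate p r)) rest
    head-p = proj₁ (pivot-just rows p rest eq)
    reduce : ∀ w → inKernel rows w ≡ inKernel (p ∷ rest) w
    reduce = proj₂ (pivot-just rows p rest eq)
    p·w : ∀ b w → dot p (b ∷ w) ≡ b xor dot (rowTail p) w
    p·w b w rewrite dot-∷ʳ p b w | head-p = refl
    kept : ∀ b w → dot p (b ∷ w) ≡ false → inKernel rows (b ∷ w) ≡ inKernel rows′ w
    kept b w p⊥w = trans (reduce (b ∷ w))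
      (trans (cong (λ z → not z ∧ inKernel rest (b ∷ w)) p⊥w)
      (trans (sym (inKernel-eliminate p rest (b ∷ w) p⊥w)) (inKernel-eliminate-∷ p rest b w head-p)))
    dropped : ∀ b w → dot p (b ∷ w) ≡ true → inKernel rows (b ∷ w) ≡ false
    dropped b w p·w≡1 = trans (reduce (b ∷ w)) (cong (λ z → not z ∧ inKernel rest (b ∷ w)) p·w≡1)
    pair : ∀ w → [ inKernel rows (false ∷ w) ] + [ inKernel rows (true ∷ w) ] ≡ [ inKernel rows′ w ]
    pair w with dot (rowTail p) w in eq-p
    ... | false = trans (cong₂ _+_ (cong [_] (kept false w (trans (p·w false w) eq-p)))
                                   (cong [_] (dropped true w (trans (p·w true w) (cong not eq-p)))))
                        (+-identityʳ _)
    ... | true  = cong₂ _+_ (cong [_] (dropped false w (trans (p·w false w) eq-p)))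
                            (cong [_] (kept true w (trans (p·w true w) (cong not eq-p))))

  kernelSize-rankCols : ∀ c rows → kernelSize c rows ≡ 2 ^ (c ∸ rankCols c rows)
  kernelSize-rankCols zero    rows rewrite inKernel-[] rows = refl
  kernelSize-rankCols (suc c) rows with pivot rows in eq
  ... | nothing =
    trans (kernelSize-noPivot c rows eq)
          (trans (cong (2 *_) (kernelSize-rankCols c (map rowTail rows)))
                 (cong (2 ^_) (sym (+-∸-assoc 1 (rankCols≤ c (map rowTail rows))))))
  ... | just (p , rest) = trans (kernelSize-pivot c rows p rest eq) (kernelSize-rankCols c _)

  nullity : List (List Bool) → ℕ
  nullity M = length M ∸ rank2 M

  kernelSize-nullity : ∀ M → kernelSize (length M) M ≡ 2 ^ nullity M
  kernelSize-nullity M = kernelSize-rankCols (length M) M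

  rank+nullity : ∀ M → rank2 M + nullity M ≡ length M
  rank+nullity M = m+[n∸m]≡n (rankCols≤ (length M) M)

  2^-injective : ∀ a b → 2 ^ a ≡ 2 ^ b → a ≡ b
  2^-injective zero    zero    _  = refl
  2^-injective zero    (suc b) eq with m^n≡1⇒n≡0∨m≡1 2 (suc b) (sym eq)
  ... | inj₁ ()
  ... | inj₂ ()
  2^-injective (suc a) zero    eq with m^n≡1⇒n≡0∨m≡1 2 (suc a) eq
  ... | inj₁ ()
  ... | inj₂ ()
  2^-injective (suc a) (suc b) eq = cong suc (2^-injective a b (*-cancelˡ-≡ (2 ^ a) (2 ^ b) 2 eq))

  kernelSize≡2^nullity : ∀ {n} M → length M ≡ n → kernelSize n M ≡ 2 ^ nullity M
  kernelSize≡2^nullity M refl = kernelSize-nullity M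

  rank-from-nullity : ∀ M r n → length M ≡ r + n → nullity M ≡ n → rank2 M ≡ r
  rank-from-nullity M r n len nul =
    +-cancelʳ-≡ n (rank2 M) r (trans (cong (rank2 M +_) (sym nul)) (trans (rank+nullity M) len))

module Fredholm where

  open import Data.Bool using (Bool; true; false; _xor_; _∧_; not; if_then_else_)
  open import Data.Bool.Properties using (xor-identityʳ; xor-same; xor-assoc; xor-comm; ∧-assoc)
  open import Data.List using (List; []; _∷_; map; length; _++_; replicate)
  open import Data.List.Properties using (length-map; length-++; map-++; map-cong; map-∘; length-replicate)
  open import Data.List.Relation.Unary.All using (All; []; _∷_)
  open import Data.List.Relation.Unary.All.Properties using (++⁺)
  open import Data.Nat using (ℕ; zero; suc; _+_)
  open import Data.Nat.Properties using (suc-injective)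
  open import Data.Product using (_×_; _,_; proj₁; proj₂; Σ-syntax)
  open import Data.Sum using (_⊎_; inj₁; inj₂)
  open import Relation.Binary.PropositionalEquality
  open BoolVector

  -- A linear equation  r · x = b  over GF(2).
  Equation : Set
  Equation = List Bool × Bool

  satisfies : List Equation → List Bool → Bool
  satisfies []            x = true
  satisfies ((r , b) ∷ E) x = not (dot r x xor b) ∧ satisfies E x

  lhsCombination : List Bool → List Equation → List Bool → Bool
  lhsCombination y E x = dot y (map (λ e → dot (proj₁ e) x) E)

  rhsCombination : List Bool → List Equation → Bool
  rhsCombination y E = dot y (map proj₂ E)

  Solvable : ℕ → List Equation → Set
  Solvable c E = Σ[ x ∈ List Bool ] length x ≡ c × satisfies E x ≡ true

  Inconsistent : ℕ → List Equation → Set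
  Inconsistent c E = Σ[ y ∈ List Bool ] length y ≡ length E
                     × (∀ x → length x ≡ c → lhsCombination y E x ≡ false) × rhsCombination y E ≡ true

  HeadFree : List Equation → Set
  HeadFree = All (λ e → rowHead (proj₁ e) ≡ false)

  dropHead : Equation → Equation
  dropHead (r , b) = rowTail r , b

  dot-headFree : ∀ r b x → rowHead r ≡ false → dot r (b ∷ x) ≡ dot (rowTail r) x
  dot-headFree r b x head≡ rewrite dot-∷ʳ r b x | head≡ = refl

  satisfies-headFree : ∀ E b x → HeadFree E → satisfies E (b ∷ x) ≡ satisfies (map dropHead E) x
  satisfies-headFree []            b x []           = refl
  satisfies-headFree ((r , c) ∷ E) b x (h ∷ hs) rewrite dot-headFree r b x h =
    cong (_ ∧_) (satisfies-headFree E b x hs)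

  lhs-headFree : ∀ E b x → HeadFree E → map (λ e → dot (proj₁ e) (b ∷ x)) E ≡ map (λ e → dot (proj₁ e) x) (map dropHead E)
  lhs-headFree []      b x []       = refl
  lhs-headFree (e ∷ E) b x (h ∷ hs) = cong₂ _∷_ (dot-headFree (proj₁ e) b x h) (lhs-headFree E b x hs)

  rhs-dropHead : ∀ E → map proj₂ (map dropHead E) ≡ map proj₂ E
  rhs-dropHead []      = refl
  rhs-dropHead (e ∷ E) = cong (proj₂ e ∷_) (rhs-dropHead E)

  satisfies-++ : ∀ A B x → satisfies (A ++ B) x ≡ satisfies A x ∧ satisfies B x
  satisfies-++ []            B x = refl
  satisfies-++ ((r , b) ∷ A) B x =
    trans (cong (_ ∧_) (satisfies-++ A B x)) (sym (∧-assoc (not (dot r x xor b)) (satisfies A x) (satisfies B x)))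

  reduceBy : List Bool → Bool → Equation → Equation
  reduceBy p bp (r , b) = if rowHead r then (xorRow r p , b xor bp) else (r , b)

  reduceBy-headFree : ∀ p bp E → rowHead p ≡ true → HeadFree (map (reduceBy p bp) E)
  reduceBy-headFree p bp []            head-p = []
  reduceBy-headFree p bp ((r , b) ∷ E) head-p with rowHead r in head-r
  ... | true  = trans (rowHead-xorRow r p) (cong₂ _xor_ head-r head-p) ∷ reduceBy-headFree p bp E head-p
  ... | false = head-r ∷ reduceBy-headFree p bp E head-p

  satisfies-reduceBy : ∀ p bp E x → dot p x ≡ bp → satisfies (map (reduceBy p bp) E) x ≡ satisfies E x
  satisfies-reduceBy p bp []            x p·x = refl
  satisfies-reduceBy p bp ((r , b) ∷ E) x p·x with rowHead r
  ... | true  = cong₂ _∧_ (cong not (trans (cong (_xor (b xor bp)) (trans (dot-xorRowˡ r p x) (cong (dot r x xor_) p·x)))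
                                            (cancel (dot r x) bp b)))
                          (satisfies-reduceBy p bp E x p·x)
    where
    cancel : ∀ a c b → (a xor c) xor (b xor c) ≡ a xor b
    cancel a c b = trans (xor-interchange a c b c) (trans (cong ((a xor b) xor_) (xor-same c)) (xor-identityʳ _))
  ... | false = cong (_ ∧_) (satisfies-reduceBy p bp E x p·x)

  -- A certificate for the reduced system lifts to the original one: the coefficient of the pivot
  -- equation is the combination of the leading entries of the reduced equations.
  lift-combination : ∀ (value : Equation → Bool) p bp pre post (yA yB : List Bool) → length yA ≡ length pre →
    (∀ e → value e ≡ value (reduceBy p bp e) xor (rowHead (proj₁ e) ∧ value (p , bp))) →
    dot (yA ++ dot yB (map (λ e → rowHead (proj₁ e)) post) ∷ yB) (map value (pre ++ (p , bp) ∷ post))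
      ≡ dot (yA ++ yB) (map value (pre ++ map (reduceBy p bp) post))
  lift-combination value p bp pre post yA yB len-yA value-reduce = begin
      dot (yA ++ C ∷ yB) (map value (pre ++ (p , bp) ∷ post))
    ≡⟨ cong (dot (yA ++ C ∷ yB)) (map-++ value pre ((p , bp) ∷ post)) ⟩
      dot (yA ++ C ∷ yB) (map value pre ++ Vp ∷ map value post)
    ≡⟨ dot-++ yA (C ∷ yB) (map value pre) (Vp ∷ map value post) len ⟩
      A xor ((C ∧ Vp) xor dot yB (map value post))
    ≡⟨ cong (λ z → A xor ((C ∧ Vp) xor z)) post-value ⟩
      A xor ((C ∧ Vp) xor ((C ∧ Vp) xor Z))
    ≡⟨ cong (A xor_) (trans (sym (xor-assoc (C ∧ Vp) (C ∧ Vp) Z)) (cong (_xor Z) (xor-same (C ∧ Vp)))) ⟩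
      A xor Z
    ≡⟨ dot-++ yA yB (map value pre) (map value (map (reduceBy p bp) post)) len ⟨
      dot (yA ++ yB) (map value pre ++ map value (map (reduceBy p bp) post))
    ≡⟨ cong (dot (yA ++ yB)) (map-++ value pre (map (reduceBy p bp) post)) ⟨
      dot (yA ++ yB) (map value (pre ++ map (reduceBy p bp) post))
    ∎
    where
    open ≡-Reasoning
    C  = dot yB (map (λ e → rowHead (proj₁ e)) post)
    Vp = value (p , bp)
    A  = dot yA (map value pre)
    Z  = dot yB (map value (map (reduceBy p bp) post))
    len : length yA ≡ length (map value pre)
    len = trans len-yA (sym (length-map value pre))
    post-value : dot yB (map value post) ≡ (C ∧ Vp) xor Z
    post-value = begin
        dot yB (map value post)
      ≡⟨ cong (dot yB) (map-cong value-reduce post) ⟩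
        dot yB (map (λ e → value (reduceBy p bp e) xor (rowHead (proj₁ e) ∧ Vp)) post)
      ≡⟨ dot-comm yB _ ⟩
        dot (map (λ e → value (reduceBy p bp e) xor (rowHead (proj₁ e) ∧ Vp)) post) yB
      ≡⟨ dot-map-xor post (λ e → value (reduceBy p bp e)) (λ e → rowHead (proj₁ e) ∧ Vp) yB ⟩
        dot (map (λ e → value (reduceBy p bp e)) post) yB xor dot (map (λ e → rowHead (proj₁ e) ∧ Vp) post) yB
      ≡⟨ cong₂ _xor_ (trans (dot-comm _ yB) (cong (dot yB) (map-∘ post)))
                     (trans (dot-map-∧ʳ post (λ e → rowHead (proj₁ e)) Vp yB) (cong (_∧ Vp) (dot-comm _ yB))) ⟩
        Z xor (C ∧ Vp)
      ≡⟨ xor-comm Z (C ∧ Vp) ⟩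
        (C ∧ Vp) xor Z
      ∎

  findPivot : ∀ E → HeadFree E ⊎ Σ[ pre ∈ List Equation ] Σ[ p ∈ List Bool ] Σ[ bp ∈ Bool ] Σ[ post ∈ List Equation ]
                                  (E ≡ pre ++ (p , bp) ∷ post) × HeadFree pre × rowHead p ≡ true
  findPivot []            = inj₁ []
  findPivot ((r , b) ∷ E) with rowHead r in head-r
  ... | true  = inj₂ ([] , r , b , E , refl , [] , head-r)
  ... | false with findPivot E
  ...   | inj₁ free = inj₁ (head-r ∷ free)
  ...   | inj₂ (pre , p , bp , post , refl , free , head-p) =
    inj₂ ((r , b) ∷ pre , p , bp , post , refl , head-r ∷ free , head-p)

  splitLength : ∀ n m (y : List Bool) → length y ≡ n + m →
                Σ[ yA ∈ List Bool ] Σ[ yB ∈ List Bool ] y ≡ yA ++ yB × length yA ≡ n × length yB ≡ m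
  splitLength zero    m y       l = [] , y , refl , refl , l
  splitLength (suc n) m (b ∷ y) l with splitLength n m y (suc-injective l)
  ... | yA , yB , refl , lA , lB = b ∷ yA , yB , refl , cong suc lA , lB

  Alternative : ℕ → List Equation → Set
  Alternative c E = Solvable c E ⊎ Inconsistent c E

  alternative-0 : ∀ E → Alternative 0 E
  alternative-0 [] = inj₁ ([] , refl , refl)
  alternative-0 ((r , true) ∷ E) =
    inj₂ (true ∷ replicate (length E) false , cong suc (length-replicate (length E)) ,
          (λ { [] _ → cong₂ _xor_ (dot-[]ʳ r) (dot-replicateˡ (length E) _) }) ,
          cong not (dot-replicateˡ (length E) _))
  alternative-0 ((r , false) ∷ E) with alternative-0 E
  ... | inj₁ ([] , refl , sat) = inj₁ ([] , refl , trans (cong (λ z → not (z xor false) ∧ satisfies E []) (dot-[]ʳ r)) sat)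
  ... | inj₂ (y , l , lhs , rhs) = inj₂ (false ∷ y , cong suc l , lhs , rhs)

  alternative-headFree : ∀ c E → HeadFree E → Alternative c (map dropHead E) → Alternative (suc c) E
  alternative-headFree c E free (inj₁ (x , l , sat)) =
    inj₁ (false ∷ x , cong suc l , trans (satisfies-headFree E false x free) sat)
  alternative-headFree c E free (inj₂ (y , l , lhs , rhs)) =
    inj₂ (y , trans l (length-map dropHead E) ,
          (λ { (x₀ ∷ x) lx → trans (cong (dot y) (lhs-headFree E x₀ x free)) (lhs x (suc-injective lx)) }) ,
          trans (cong (dot y) (sym (rhs-dropHead E))) rhs)

  module _ (c : ℕ) (pre : List Equation) (p : List Bool) (bp : Bool) (post : List Equation)
           (free : HeadFree pre) (head-p : rowHead p ≡ true) where

    private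
      post′ = map (reduceBy p bp) post
      E′ = map dropHead (pre ++ post′)
      free′ : HeadFree (pre ++ post′)
      free′ = ++⁺ free (reduceBy-headFree p bp post head-p)

    -- The eliminated unknown is recovered from the pivot equation.
    solvable-pivot : Solvable c E′ → Solvable (suc c) (pre ++ (p , bp) ∷ post)
    solvable-pivot (x′ , l , sat) = x₀ ∷ x′ , cong suc l , sat-x
      where
      x₀ = bp xor dot (rowTail p) x′
      p·x : dot p (x₀ ∷ x′) ≡ bp
      p·x rewrite dot-∷ʳ p x₀ x′ | head-p = xor-cancelʳ bp _
      sat-rest : satisfies pre (x₀ ∷ x′) ∧ satisfies post′ (x₀ ∷ x′) ≡ true
      sat-rest = trans (sym (satisfies-++ pre post′ _)) (trans (satisfies-headFree (pre ++ post′) x₀ x′ free′) sat)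
      sat-x : satisfies (pre ++ (p , bp) ∷ post) (x₀ ∷ x′) ≡ true
      sat-x = trans (satisfies-++ pre ((p , bp) ∷ post) _)
        (cong₂ _∧_ (proj₁ (∧≡true (satisfies pre (x₀ ∷ x′)) _ sat-rest))
                   (cong₂ _∧_ (cong not (trans (cong (_xor bp) p·x) (xor-same bp)))
                              (trans (sym (satisfies-reduceBy p bp post _ p·x)) (proj₂ (∧≡true (satisfies pre (x₀ ∷ x′)) _ sat-rest)))))

    inconsistent-pivot : Inconsistent c E′ → Inconsistent (suc c) (pre ++ (p , bp) ∷ post)
    inconsistent-pivot (y′ , l , lhs , rhs)
      with splitLength (length pre) (length post) y′
             (trans l (trans (length-map dropHead (pre ++ post′))
                      (trans (length-++ pre) (cong (length pre +_) (length-map (reduceBy p bp) post)))))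
    ... | yA , yB , refl , lA , lB =
      yA ++ C ∷ yB , trans (length-++ yA) (trans (cong₂ _+_ lA (cong suc lB)) (sym (length-++ pre))) , lhs′ , rhs′
      where
      C = dot yB (map (λ e → rowHead (proj₁ e)) post)
      lhs′ : ∀ x → length x ≡ suc c → lhsCombination (yA ++ C ∷ yB) (pre ++ (p , bp) ∷ post) x ≡ false
      lhs′ (x₀ ∷ x) lx =
        trans (lift-combination (λ e → dot (proj₁ e) (x₀ ∷ x)) p bp pre post yA yB lA value-reduce)
              (trans (cong (dot (yA ++ yB)) (lhs-headFree (pre ++ post′) x₀ x free′)) (lhs x (suc-injective lx)))
        where
        value-reduce : ∀ e → dot (proj₁ e) (x₀ ∷ x) ≡ dot (proj₁ (reduceBy p bp e)) (x₀ ∷ x) xor (rowHead (proj₁ e) ∧ dot p (x₀ ∷ x))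
        value-reduce (r , b) with rowHead r
        ... | true  = sym (trans (cong (_xor dot p (x₀ ∷ x)) (dot-xorRowˡ r p (x₀ ∷ x))) (xor-cancelʳ _ _))
        ... | false = sym (xor-identityʳ _)
      rhs′ : rhsCombination (yA ++ C ∷ yB) (pre ++ (p , bp) ∷ post) ≡ true
      rhs′ = trans (lift-combination proj₂ p bp pre post yA yB lA value-reduce)
                   (trans (cong (dot (yA ++ yB)) (sym (rhs-dropHead (pre ++ post′)))) rhs)
        where
        value-reduce : ∀ e → proj₂ e ≡ proj₂ (reduceBy p bp e) xor (rowHead (proj₁ e) ∧ bp)
        value-reduce (r , b) with rowHead r
        ... | true  = sym (xor-cancelʳ b bp)
        ... | false = sym (xor-identityʳ b)

  solvable-or-inconsistent : ∀ c E → Alternative c E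
  solvable-or-inconsistent zero    E = alternative-0 E
  solvable-or-inconsistent (suc c) E with findPivot E
  ... | inj₁ free = alternative-headFree c E free (solvable-or-inconsistent c (map dropHead E))
  ... | inj₂ (pre , p , bp , post , refl , free , head-p)
    with solvable-or-inconsistent c (map dropHead (pre ++ map (reduceBy p bp) post))
  ...   | inj₁ sol = inj₁ (solvable-pivot c pre p bp post free head-p sol)
  ...   | inj₂ cert = inj₂ (inconsistent-pivot c pre p bp post free head-p cert)

module BlockMatrices where

  open import Data.Bool using (Bool; true; false; _xor_; _∧_; not)
  open import Data.Bool.ListAction using (all)
  open import Data.Bool.Properties using (xor-comm; xor-assoc; ∧-assoc)
  open import Data.List using (List; []; _∷_; map; length; _++_)
  open import Data.List.Properties using (length-map)
  open import Data.Product using (proj₁; proj₂)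
  open import Relation.Binary.PropositionalEquality
  open BoolVector
  open KernelCount using (inKernel)

  all-cong : ∀ {a} {I : Set a} (L : List I) {g h : I → Bool} → (∀ i → g i ≡ h i) → all g L ≡ all h L
  all-cong []      g≗h = refl
  all-cong (i ∷ L) g≗h = cong₂ _∧_ (g≗h i) (all-cong L g≗h)

  inKernel-map : ∀ {a} {I : Set a} (row : I → List Bool) L w → inKernel (map row L) w ≡ all (λ i → not (dot (row i) w)) L
  inKernel-map row []      w = refl
  inKernel-map row (i ∷ L) w = cong (_ ∧_) (inKernel-map row L w)

  inKernel-++ : ∀ A B w → inKernel (A ++ B) w ≡ inKernel A w ∧ inKernel B w
  inKernel-++ []      B w = refl
  inKernel-++ (r ∷ A) B w = trans (cong (_ ∧_) (inKernel-++ A B w)) (sym (∧-assoc (not (dot r w)) (inKernel A w) _))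

  module _ {a} {I : Set a} where

    submatrix : (I → I → Bool) → List I → List (List Bool)
    submatrix f S = map (λ i → map (f i) S) S

    -- The submatrix on S bordered by an unlooped vertex with neighbourhood u.
    bordered : (I → I → Bool) → (I → Bool) → List I → List (List Bool)
    bordered f u S = (false ∷ map u S) ∷ map (λ i → u i ∷ map (f i) S) S

    solves : (I → I → Bool) → List I → (I → Bool) → List Bool → Bool
    solves f S h s = all (λ i → not (h i xor dot (map (f i) S) s)) S

    inKernel-submatrix : ∀ f S s → inKernel (submatrix f S) s ≡ solves f S (λ _ → false) s
    inKernel-submatrix f S s = inKernel-map _ S s

    inKernel-bordered : ∀ f u S s₀ s →
      inKernel (bordered f u S) (s₀ ∷ s) ≡ not (dot (map u S) s) ∧ solves f S (λ i → u i ∧ s₀) s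
    inKernel-bordered f u S s₀ s = cong (_ ∧_) (inKernel-map _ S (s₀ ∷ s))

    solves-cong : ∀ f S {h h′ : I → Bool} s → (∀ i → h i ≡ h′ i) → solves f S h s ≡ solves f S h′ s
    solves-cong f S s h≗h′ = all-cong S (λ i → cong (λ z → not (z xor _)) (h≗h′ i))

    solves⇒≡mulVec : ∀ f S h s → solves f S h s ≡ true → map h S ≡ mulVec f S S s
    solves⇒≡mulVec f S h s = go S
      where
      not-xor≡true : ∀ x y → not (x xor y) ≡ true → x ≡ y
      not-xor≡true true  true  _ = refl
      not-xor≡true false false _ = refl
      go : ∀ L → all (λ i → not (h i xor dot (map (f i) S) s)) L ≡ true → map h L ≡ map (λ i → dot (map (f i) S) s) L
      go []      _   = refl
      go (i ∷ L) sol = cong₂ _∷_ (not-xor≡true _ _ (proj₁ (∧≡true _ _ sol))) (go L (proj₂ (∧≡true _ _ sol)))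

    solves-translate : ∀ f S h h′ s w → map h′ S ≡ mulVec f S S w →
                       solves f S h (xorRow s w) ≡ solves f S (λ i → h i xor h′ i) s
    solves-translate f S h h′ s w Aw≡h′ = go S Aw≡h′
      where
      rearrange : ∀ x y z → x xor (y xor z) ≡ (x xor z) xor y
      rearrange x y z = trans (cong (x xor_) (xor-comm y z)) (sym (xor-assoc x z y))
      go : ∀ L → map h′ L ≡ map (λ i → dot (map (f i) S) w) L →
           all (λ i → not (h i xor dot (map (f i) S) (xorRow s w))) L ≡ all (λ i → not ((h i xor h′ i) xor dot (map (f i) S) s)) L
      go []      _  = refl
      go (i ∷ L) eq =
        cong₂ _∧_ (cong not (trans (cong (h i xor_) (dot-xorRowʳ (map (f i) S) s w))
                            (trans (cong (λ z → h i xor (dot (map (f i) S) s xor z)) (sym (head eq)))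
                                   (rearrange (h i) _ (h′ i)))))
                  (go L (tail eq))
        where
        head : ∀ {x y : Bool} {xs ys} → x ∷ xs ≡ y ∷ ys → x ≡ y
        head refl = refl
        tail : ∀ {x y : Bool} {xs ys} → x ∷ xs ≡ y ∷ ys → xs ≡ ys
        tail refl = refl

  module _ {a b} {I : Set a} {J : Set b} where

    -- The adjacency matrix of S ∪ T when every u-neighbour in S is joined to every v-neighbour in T.
    glued : (I → I → Bool) → (I → Bool) → (J → J → Bool) → (J → Bool) → List I → List J → List (List Bool)
    glued f u g v S T = map (λ i → map (f i) S ++ map (λ j → u i ∧ v j) T) S
                     ++ map (λ j → map (λ i → v j ∧ u i) S ++ map (g j) T) T

    inKernel-glued : ∀ f u g v S T s t → length s ≡ length S →
      inKernel (glued f u g v S T) (s ++ t)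
        ≡ solves f S (λ i → u i ∧ dot (map v T) t) s ∧ solves g T (λ j → v j ∧ dot (map u S) s) t
    inKernel-glued f u g v S T s t len-s =
      trans (inKernel-++ (map _ S) (map _ T) (s ++ t))
        (cong₂ _∧_ (trans (inKernel-map _ S (s ++ t)) (all-cong S row-S)) (trans (inKernel-map _ T (s ++ t)) (all-cong T row-T)))
      where
      row-S : ∀ i → not (dot (map (f i) S ++ map (λ j → u i ∧ v j) T) (s ++ t)) ≡ not ((u i ∧ dot (map v T) t) xor dot (map (f i) S) s)
      row-S i = cong not (trans (dot-++ (map (f i) S) _ s t (trans (length-map (f i) S) (sym len-s)))
                         (trans (cong (dot (map (f i) S) s xor_) (dot-map-∧ˡ T (u i) v t)) (xor-comm (dot (map (f i) S) s) _)))
      row-T : ∀ j → not (dot (map (λ i → v j ∧ u i) S ++ map (g j) T) (s ++ t)) ≡ not ((v j ∧ dot (map u S) s) xor dot (map (g j) T) t)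
      row-T j = cong not (trans (dot-++ (map (λ i → v j ∧ u i) S) _ s t (trans (length-map _ S) (sym len-s)))
                         (cong (_xor dot (map (g j) T) t) (dot-map-∧ˡ S (v j) u s)))

module SpanCases where

  open import Data.Bool using (Bool; true; false; _xor_; _∧_; not)
  open import Data.Bool.Properties using (xor-comm; true-xor; ∧-comm; ∧-zeroʳ; ∧-identityʳ; xor-identityʳ; xor-same; not-involutive)
  open import Data.Empty using (⊥-elim)
  open import Data.List using (List; []; _∷_; map; length)
  open import Data.List.Properties using (length-map; length-++)
  open import Data.Nat using (ℕ; suc; _+_; _*_; pred)
  open import Data.Nat.Properties
    using (+-identityʳ; *-zeroʳ; *-assoc; *-distribˡ-+; +-suc; ^-distribˡ-+-*; +-commutativeSemigroup; +-*-commutativeSemiring)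
  open import Data.Nat.Tactic.RingSolver using (solve-∀)
  open import Data.Product using (_×_; _,_; proj₁; proj₂; Σ-syntax)
  open import Data.Sum using (_⊎_; inj₁; inj₂)
  open import Algebra.Properties.CommutativeSemigroup +-commutativeSemigroup using (interchange)
  open import Relation.Binary.PropositionalEquality hiding ([_])
  open BoolVector
  open BooleanCube
  open KernelCount
  open Fredholm using (Equation; satisfies; solvable-or-inconsistent)
  open import Data.Bool.ListAction using (all)
  open BlockMatrices
  open ListSum +-*-commutativeSemiring using (∑-cong; ∑-+; ∑-*ˡ; ∑-*ʳ; ∑-zero; ∑-comm)

  [x]≡[x∧¬y]+[x∧y] : ∀ x y → [ x ] ≡ [ x ∧ not y ] + [ x ∧ y ]
  [x]≡[x∧¬y]+[x∧y] false y     = refl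
  [x]≡[x∧¬y]+[x∧y] true  false = refl
  [x]≡[x∧¬y]+[x∧y] true  true  = refl

  [∧] : ∀ x y → [ x ∧ y ] ≡ [ x ] * [ y ]
  [∧] true  y = sym (+-identityʳ _)
  [∧] false y = refl

  module _ {a} {I : Set a} where

    kernelSize-submatrix : ∀ f (S : List I) → kernelSize (length S) (submatrix f S) ≡ ∑𝔹 (length S) (λ s → [ solves f S (λ _ → false) s ])
    kernelSize-submatrix f S = ∑-cong (vectors (length S)) (λ s → cong [_] (inKernel-submatrix f S s))

    kernelSize-bordered : ∀ f u (S : List I) → kernelSize (suc (length S)) (bordered f u S)
      ≡ ∑𝔹 (length S) (λ s → [ not (dot (map u S) s) ∧ solves f S (λ i → u i ∧ false) s ])
      + ∑𝔹 (length S) (λ s → [ not (dot (map u S) s) ∧ solves f S (λ i → u i ∧ true) s ])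
    kernelSize-bordered f u S = trans (∑𝔹-suc (length S) _)
      (cong₂ _+_ (∑-cong (vectors (length S)) (λ s → cong [_] (inKernel-bordered f u S false s)))
                 (∑-cong (vectors (length S)) (λ s → cong [_] (inKernel-bordered f u S true s))))

  module _ {a b} {I : Set a} {J : Set b} where

    kernelSize-glued : ∀ f u g v (S : List I) (T : List J) →
      kernelSize (length S + length T) (glued f u g v S T)
        ≡ ∑𝔹 (length S) (λ s → ∑𝔹 (length T) (λ t →
            [ solves f S (λ i → u i ∧ dot (map v T) t) s ∧ solves g T (λ j → v j ∧ dot (map u S) s) t ]))
    kernelSize-glued f u g v S T = trans (∑𝔹-++ (length S) (length T) _)
      (∑𝔹-cong (length S) (λ s l → ∑-cong (vectors (length T)) (λ t → cong [_] (inKernel-glued f u g v S T s t l))))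

  module _ {a b} {I : Set a} {J : Set b} (f : I → I → Bool) (f-sym : Symmetric f) (f-diag : ZeroDiagonal f)
           (u : I → Bool) (S : List I) where

    private
      c = length S
      U : List Bool → Bool
      U s = dot (map u S) s
      ker : List Bool → Bool
      ker s = solves f S (λ _ → false) s
      N N₀ N₁ : ℕ
      N  = ∑𝔹 c (λ s → [ ker s ])
      N₀ = ∑𝔹 c (λ s → [ ker s ∧ not (U s) ])
      N₁ = ∑𝔹 c (λ s → [ ker s ∧ U s ])

      N≡N₀+N₁ : N ≡ N₀ + N₁
      N≡N₀+N₁ = trans (∑-cong (vectors c) (λ s → [x]≡[x∧¬y]+[x∧y] (ker s) (U s))) (∑-+ (vectors c) _ _)

      U-translate : ∀ s w → U (xorRow s w) ≡ U s xor U w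
      U-translate s w = dot-xorRowʳ (map u S) s w

      kernelSize-bordered′ : kernelSize (suc c) (bordered f u S)
        ≡ ∑𝔹 c (λ s → [ not (U s) ∧ ker s ]) + ∑𝔹 c (λ s → [ not (U s) ∧ solves f S u s ])
      kernelSize-bordered′ = trans (kernelSize-bordered f u S)
        (cong₂ _+_ (∑-cong (vectors c) (λ s → cong (λ z → [ not (U s) ∧ z ]) (solves-cong f S s (λ i → ∧-zeroʳ (u i)))))
                   (∑-cong (vectors c) (λ s → cong (λ z → [ not (U s) ∧ z ]) (solves-cong f S s (λ i → ∧-identityʳ (u i))))))

      true≢false : true ≢ false
      true≢false ()

      equations : List Equation
      equations = map (λ i → map (f i) S , u i) S

      satisfies-rows : ∀ L x → satisfies (map (λ i → map (f i) S , u i) L) x ≡ all (λ i → not (u i xor dot (map (f i) S) x)) L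
      satisfies-rows []      x = refl
      satisfies-rows (i ∷ L) x = cong₂ _∧_ (cong not (xor-comm _ (u i))) (satisfies-rows L x)

      lhs-rows : ∀ L x → map (λ e → dot (proj₁ e) x) (map (λ i → map (f i) S , u i) L) ≡ map (λ i → dot (map (f i) S) x) L
      lhs-rows []      x = refl
      lhs-rows (i ∷ L) x = cong (_ ∷_) (lhs-rows L x)

      rhs-rows : ∀ L → map proj₂ (map (λ i → map (f i) S , u i) L) ≡ map u L
      rhs-rows []      = refl
      rhs-rows (i ∷ L) = cong (_ ∷_) (rhs-rows L)

    -- Over GF(2) the column space of the symmetric matrix A is the orthogonal complement of ker A.
    columnSpace-dichotomy : (Σ[ w₀ ∈ List Bool ] length w₀ ≡ c × map u S ≡ mulVec f S S w₀)
                          ⊎ (Σ[ s₁ ∈ List Bool ] length s₁ ≡ c × ker s₁ ∧ U s₁ ≡ true)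
    columnSpace-dichotomy with search𝔹 c (λ s → ker s ∧ U s)
    ... | inj₁ witness = inj₂ witness
    ... | inj₂ ker⊥u with solvable-or-inconsistent c equations
    ...   | inj₁ (w₀ , len₀ , sat) = inj₁ (w₀ , len₀ , solves⇒≡mulVec f S u w₀ (trans (sym (satisfies-rows S w₀)) sat))
    ...   | inj₂ (y , len-y , lhs , rhs) =
      ⊥-elim (true≢false (trans (sym (cong₂ _∧_ ker-y U-y)) (ker⊥u y (trans len-y (length-map _ S)))))
      where
      ker-y : ker y ≡ true
      ker-y = orthogonal-to-all⇒zero S (λ i → dot (map (f i) S) y)
        (λ x lx → trans (sym (dot-mulVec-sym f f-sym S S x y))
                        (trans (dot-comm (mulVec f S S x) y) (trans (cong (dot y) (sym (lhs-rows S x))) (lhs x lx))))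
      U-y : U y ≡ true
      U-y = trans (dot-comm (map u S) y) (trans (cong (dot y) (sym (rhs-rows S))) rhs)

    module OutsideSpan (s₁ : List Bool) (len₁ : length s₁ ≡ c) (ker∧U : ker s₁ ∧ U s₁ ≡ true) where

      private
        U-s₁ : U s₁ ≡ true
        U-s₁ = proj₂ (∧≡true (ker s₁) _ ker∧U)
        As₁≡0 : map (λ _ → false) S ≡ mulVec f S S s₁
        As₁≡0 = solves⇒≡mulVec f S (λ _ → false) s₁ (proj₁ (∧≡true (ker s₁) _ ker∧U))

      -- A s = u would force U s₁ = (A s) · s₁ = s · (A s₁) = 0.
      unsolvable : ∀ s → solves f S u s ≡ false
      unsolvable s with solves f S u s in sol
      ... | false = refl
      ... | true  = ⊥-elim (true≢false (begin
          true                        ≡⟨ U-s₁ ⟨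
          dot (map u S) s₁            ≡⟨ cong (λ z → dot z s₁) (solves⇒≡mulVec f S u s sol) ⟩
          dot (mulVec f S S s) s₁     ≡⟨ dot-mulVec-sym f f-sym S S s s₁ ⟩
          dot (mulVec f S S s₁) s     ≡⟨ cong (λ z → dot z s) As₁≡0 ⟨
          dot (map (λ _ → false) S) s ≡⟨ dot-map-false S s ⟩
          false                       ∎))
        where open ≡-Reasoning

      N₀≡N₁ : N₀ ≡ N₁
      N₀≡N₁ = trans (sym (∑𝔹-translate c (λ s → [ ker s ∧ not (U s) ]) s₁ len₁))
        (∑-cong (vectors c) (λ s → cong [_] (cong₂ _∧_ (ker-translate s) (trans (cong not (U-translate-s₁ s)) (not-involutive (U s))))))
        where
        ker-translate : ∀ s → ker (xorRow s s₁) ≡ ker s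
        ker-translate s = solves-translate f S (λ _ → false) (λ _ → false) s s₁ As₁≡0
        U-translate-s₁ : ∀ s → U (xorRow s s₁) ≡ not (U s)
        U-translate-s₁ s = trans (U-translate s s₁) (trans (cong (U s xor_) U-s₁) (trans (xor-comm (U s) true) (true-xor (U s))))

      2*N₀≡A : 2 * N₀ ≡ kernelSize c (submatrix f S)
      2*N₀≡A = trans (cong (N₀ +_) (trans (+-identityʳ N₀) N₀≡N₁)) (trans (sym N≡N₀+N₁) (sym (kernelSize-submatrix f S)))

      bordered-size : 2 * kernelSize (suc c) (bordered f u S) ≡ kernelSize c (submatrix f S)
      bordered-size = trans (cong (2 *_) bordered≡N₀) 2*N₀≡A
        where
        bordered≡N₀ : kernelSize (suc c) (bordered f u S) ≡ N₀
        bordered≡N₀ = trans kernelSize-bordered′ (trans (cong₂ _+_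
          (∑-cong (vectors c) (λ s → cong [_] (∧-comm (not (U s)) (ker s))))
          (trans (∑-cong (vectors c) (λ s → cong [_] (trans (cong (not (U s) ∧_) (unsolvable s)) (∧-zeroʳ (not (U s))))))
                 (∑-zero (vectors c)))) (+-identityʳ N₀))

      -- Only t with v · t = 0 contribute, and then s ranges over ker A with B t = (u · s) v.
      glued-size : ∀ g v (T : List J) → 2 * kernelSize (c + length T) (glued f u g v S T)
                                        ≡ kernelSize c (submatrix f S) * kernelSize (suc (length T)) (bordered g v T)
      glued-size g v T = begin
          2 * kernelSize (c + m) (glued f u g v S T)
        ≡⟨ cong (2 *_) (trans (kernelSize-glued f u g v S T) (∑-cong (vectors c) (λ s → ∑-cong (vectors m) (λ t → term s t)))) ⟩
          2 * ∑𝔹 c (λ s → ∑𝔹 m (λ t → [ ker s ∧ not (U s) ] * Q false t + [ ker s ∧ U s ] * Q true t))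
        ≡⟨ cong (2 *_) (∑-cong (vectors c) (λ s → trans (∑-+ (vectors m) _ _)
                          (cong₂ _+_ (∑-*ˡ (vectors m) [ ker s ∧ not (U s) ] (Q false)) (∑-*ˡ (vectors m) [ ker s ∧ U s ] (Q true))))) ⟩
          2 * ∑𝔹 c (λ s → [ ker s ∧ not (U s) ] * ∑Q false + [ ker s ∧ U s ] * ∑Q true)
        ≡⟨ cong (2 *_) (trans (∑-+ (vectors c) _ _) (cong₂ _+_ (∑-*ʳ (vectors c) (∑Q false) _) (∑-*ʳ (vectors c) (∑Q true) _))) ⟩
          2 * (N₀ * ∑Q false + N₁ * ∑Q true)
        ≡⟨ cong (λ z → 2 * (N₀ * ∑Q false + z * ∑Q true)) N₀≡N₁ ⟨
          2 * (N₀ * ∑Q false + N₀ * ∑Q true)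
        ≡⟨ cong (2 *_) (*-distribˡ-+ N₀ (∑Q false) (∑Q true)) ⟨
          2 * (N₀ * (∑Q false + ∑Q true))
        ≡⟨ *-assoc 2 N₀ _ ⟨
          (2 * N₀) * (∑Q false + ∑Q true)
        ≡⟨ cong₂ _*_ 2*N₀≡A (sym (kernelSize-bordered g v T)) ⟩
          kernelSize c (submatrix f S) * kernelSize (suc m) (bordered g v T)
        ∎
        where
        open ≡-Reasoning
        m = length T
        V : List Bool → Bool
        V t = dot (map v T) t
        Q : Bool → List Bool → ℕ
        Q b t = [ not (V t) ∧ solves g T (λ j → v j ∧ b) t ]
        ∑Q : Bool → ℕ
        ∑Q b = ∑𝔹 m (Q b)
        term : ∀ s t → [ solves f S (λ i → u i ∧ V t) s ∧ solves g T (λ j → v j ∧ U s) t ]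
                     ≡ [ ker s ∧ not (U s) ] * Q false t + [ ker s ∧ U s ] * Q true t
        term s t with V t
        ... | true  rewrite solves-cong f S s (λ i → ∧-identityʳ (u i)) | unsolvable s
                          | *-zeroʳ [ ker s ∧ not (U s) ] | *-zeroʳ [ ker s ∧ U s ] = refl
        ... | false rewrite solves-cong f S s (λ i → ∧-zeroʳ (u i)) with U s
        ...   | true  rewrite ∧-zeroʳ (ker s) | ∧-identityʳ (ker s) = [∧] (ker s) _
        ...   | false rewrite ∧-zeroʳ (ker s) | ∧-identityʳ (ker s) = trans ([∧] (ker s) _) (sym (+-identityʳ _))

    module InSpan (w₀ : List Bool) (len₀ : length w₀ ≡ c) (Aw₀≡u : map u S ≡ mulVec f S S w₀) where

      private
        U-ker : ∀ s → ker s ≡ true → U s ≡ false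
        U-ker s ker-s = begin
          dot (map u S) s              ≡⟨ cong (λ z → dot z s) Aw₀≡u ⟩
          dot (mulVec f S S w₀) s      ≡⟨ dot-mulVec-sym f f-sym S S w₀ s ⟩
          dot (mulVec f S S s) w₀      ≡⟨ cong (λ z → dot z w₀) (solves⇒≡mulVec f S (λ _ → false) s ker-s) ⟨
          dot (map (λ _ → false) S) w₀ ≡⟨ dot-map-false S w₀ ⟩
          false                        ∎
          where open ≡-Reasoning
        U-w₀ : U w₀ ≡ false
        U-w₀ = trans (cong (λ z → dot z w₀) Aw₀≡u) (dot-mulVec-self f f-sym f-diag S w₀)
        solves-translate-w₀ : ∀ s → solves f S u (xorRow s w₀) ≡ ker s
        solves-translate-w₀ s = trans (solves-translate f S u u s w₀ Aw₀≡u) (solves-cong f S s (λ i → xor-same (u i)))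
        U-translate-w₀ : ∀ s → U (xorRow s w₀) ≡ U s
        U-translate-w₀ s = trans (U-translate s w₀) (trans (cong (U s xor_) U-w₀) (xor-identityʳ (U s)))

      ker⊆U⊥ : ∑𝔹 c (λ s → [ not (U s) ∧ ker s ]) ≡ N
      ker⊆U⊥ = ∑-cong (vectors c) pointwise
        where
        pointwise : ∀ s → [ not (U s) ∧ ker s ] ≡ [ ker s ]
        pointwise s with ker s in ker-s
        ... | true  rewrite U-ker s ker-s = refl
        ... | false = cong [_] (∧-zeroʳ (not (U s)))

      bordered-size : kernelSize (suc c) (bordered f u S) ≡ 2 * kernelSize c (submatrix f S)
      bordered-size = trans kernelSize-bordered′ (trans (cong₂ _+_ ker⊆U⊥ translated)
                        (trans (cong (N +_) (sym (+-identityʳ N))) (cong (2 *_) (sym (kernelSize-submatrix f S)))))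
        where
        translated : ∑𝔹 c (λ s → [ not (U s) ∧ solves f S u s ]) ≡ N
        translated = trans (sym (∑𝔹-translate c (λ s → [ not (U s) ∧ solves f S u s ]) w₀ len₀))
          (trans (∑-cong (vectors c) (λ s → cong [_] (cong₂ _∧_ (cong not (U-translate-w₀ s)) (solves-translate-w₀ s)))) ker⊆U⊥)

      -- For every t the admissible s form a coset of ker A on which u · s = 0.
      glued-size : ∀ g v (T : List J) → kernelSize (c + length T) (glued f u g v S T)
                                        ≡ kernelSize c (submatrix f S) * kernelSize (length T) (submatrix g T)
      glued-size g v T = begin
          kernelSize (c + m) (glued f u g v S T)
        ≡⟨ kernelSize-glued f u g v S T ⟩
          ∑𝔹 c (λ s → ∑𝔹 m (λ t → F s t))
        ≡⟨ ∑-comm (vectors c) (vectors m) F ⟩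
          ∑𝔹 m (λ t → ∑𝔹 c (λ s → F s t))
        ≡⟨ ∑-cong (vectors m) inner ⟩
          ∑𝔹 m (λ t → N * [ kerB t ])
        ≡⟨ ∑-*ˡ (vectors m) N _ ⟩
          N * ∑𝔹 m (λ t → [ kerB t ])
        ≡⟨ cong₂ _*_ (kernelSize-submatrix f S) (kernelSize-submatrix g T) ⟨
          kernelSize c (submatrix f S) * kernelSize m (submatrix g T)
        ∎
        where
        open ≡-Reasoning
        m = length T
        kerB : List Bool → Bool
        kerB t = solves g T (λ _ → false) t
        F : List Bool → List Bool → ℕ
        F s t = [ solves f S (λ i → u i ∧ dot (map v T) t) s ∧ solves g T (λ j → v j ∧ U s) t ]
        on-ker : ∀ t → ∑𝔹 c (λ s → [ ker s ∧ solves g T (λ j → v j ∧ U s) t ]) ≡ N * [ kerB t ]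
        on-ker t = trans (∑-cong (vectors c) pointwise) (∑-*ʳ (vectors c) [ kerB t ] (λ s → [ ker s ]))
          where
          pointwise : ∀ s → [ ker s ∧ solves g T (λ j → v j ∧ U s) t ] ≡ [ ker s ] * [ kerB t ]
          pointwise s with ker s in ker-s
          ... | false = refl
          ... | true rewrite U-ker s ker-s =
            trans (cong [_] (solves-cong g T t (λ j → ∧-zeroʳ (v j)))) (sym (+-identityʳ _))
        inner : ∀ t → ∑𝔹 c (λ s → F s t) ≡ N * [ kerB t ]
        inner t with dot (map v T) t
        ... | false = trans (∑-cong (vectors c) (λ s → cong (λ z → [ z ∧ solves g T (λ j → v j ∧ U s) t ])
                                                            (solves-cong f S s (λ i → ∧-zeroʳ (u i)))))
                            (on-ker t)
        ... | true  = trans (∑-cong (vectors c) (λ s → cong (λ z → [ z ∧ solves g T (λ j → v j ∧ U s) t ])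
                                                            (solves-cong f S s (λ i → ∧-identityʳ (u i)))))
                      (trans (sym (∑𝔹-translate c (λ s → [ solves f S u s ∧ solves g T (λ j → v j ∧ U s) t ]) w₀ len₀))
                      (trans (∑-cong (vectors c) (λ s → cong [_] (cong₂ _∧_ (solves-translate-w₀ s)
                                                                             (cong (λ z → solves g T (λ j → v j ∧ z) t) (U-translate-w₀ s)))))
                             (on-ker t)))

    private
      A = submatrix f S
      H = bordered f u S
      len-A : rank2 A + nullity A ≡ c
      len-A = trans (rank+nullity A) (length-map _ S)
      len-glued : ∀ g v (T : List J) → length (glued f u g v S T) ≡ c + length T
      len-glued g v T = trans (length-++ (map _ S)) (cong₂ _+_ (length-map _ S) (length-map _ T))
      len-bordered : ∀ {k} {K : Set k} g v (T : List K) → length (bordered g v T) ≡ suc (length T)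
      len-bordered g v T = cong suc (length-map _ T)

    -- u lies in the column space of A.
    Spanned : Set b
    Spanned = rank2 H ≡ rank2 A × nullity H ≡ suc (nullity A) ×
              (∀ g v (T : List J) → rank2 (glued f u g v S T) ≡ rank2 A + rank2 (submatrix g T)
                                  × nullity (glued f u g v S T) ≡ nullity A + nullity (submatrix g T))

    Unspanned : Set b
    Unspanned = rank2 H ≡ suc (suc (rank2 A)) × nullity A ≡ suc (nullity H) ×
                (∀ g v (T : List J) → rank2 (glued f u g v S T) ≡ rank2 A + rank2 (bordered g v T)
                                    × nullity (glued f u g v S T) ≡ nullity H + nullity (bordered g v T))

    spanned : kernelSize (suc c) H ≡ 2 * kernelSize c A →
              (∀ g v (T : List J) → kernelSize (c + length T) (glued f u g v S T) ≡ kernelSize c A * kernelSize (length T) (submatrix g T)) →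
              Spanned
    spanned bordered-size glued-size =
      rank-from-nullity H (rank2 A) (nullity H) (trans (len-bordered f u S) (sym len-H)) refl , nul-H , glued-ranks
      where
      kA = kernelSize≡2^nullity A (length-map _ S)
      nul-H : nullity H ≡ suc (nullity A)
      nul-H = 2^-injective _ _ (trans (sym (kernelSize≡2^nullity H (len-bordered f u S))) (trans bordered-size (cong (2 *_) kA)))
      len-H : rank2 A + nullity H ≡ suc c
      len-H = trans (cong (rank2 A +_) nul-H) (trans (+-suc (rank2 A) (nullity A)) (cong suc len-A))
      glued-ranks : ∀ g v (T : List J) → rank2 (glued f u g v S T) ≡ rank2 A + rank2 (submatrix g T)
                                       × nullity (glued f u g v S T) ≡ nullity A + nullity (submatrix g T)
      glued-ranks g v T = rank-from-nullity G _ _ len-G nul-G , nul-G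
        where
        G = glued f u g v S T
        B = submatrix g T
        nul-G : nullity G ≡ nullity A + nullity B
        nul-G = 2^-injective _ _ (trans (sym (kernelSize≡2^nullity G (len-glued g v T)))
                  (trans (glued-size g v T) (trans (cong₂ _*_ kA (kernelSize≡2^nullity B (length-map _ T)))
                         (sym (^-distribˡ-+-* 2 (nullity A) (nullity B))))))
        len-G : length G ≡ (rank2 A + rank2 B) + (nullity A + nullity B)
        len-G = trans (len-glued g v T) (trans (cong₂ _+_ (sym len-A) (sym (trans (rank+nullity B) (length-map _ T))))
                                               (interchange (rank2 A) (nullity A) (rank2 B) (nullity B)))

    unspanned : 2 * kernelSize (suc c) H ≡ kernelSize c A →
                (∀ g v (T : List J) → 2 * kernelSize (c + length T) (glued f u g v S T) ≡ kernelSize c A * kernelSize (suc (length T)) (bordered g v T)) →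
                Unspanned
    unspanned bordered-size glued-size =
      rank-from-nullity H (suc (suc (rank2 A))) (nullity H) (trans (len-bordered f u S) len-H) refl , nul-A , glued-ranks
      where
      kA = kernelSize≡2^nullity A (length-map _ S)
      kH = kernelSize≡2^nullity H (len-bordered f u S)
      nul-A : nullity A ≡ suc (nullity H)
      nul-A = 2^-injective _ _ (trans (sym kA) (trans (sym bordered-size) (cong (2 *_) kH)))
      len-H : suc c ≡ suc (suc (rank2 A)) + nullity H
      len-H = trans (cong suc (trans (sym len-A) (cong (rank2 A +_) nul-A))) (cong suc (+-suc (rank2 A) (nullity H)))
      glued-ranks : ∀ g v (T : List J) → rank2 (glued f u g v S T) ≡ rank2 A + rank2 (bordered g v T)
                                       × nullity (glued f u g v S T) ≡ nullity H + nullity (bordered g v T)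
      glued-ranks g v T = rank-from-nullity G _ _ len-G nul-G , nul-G
        where
        G = glued f u g v S T
        K = bordered g v T
        suc-nul-G : suc (nullity G) ≡ nullity A + nullity K
        suc-nul-G = 2^-injective _ _ (trans (cong (2 *_) (sym (kernelSize≡2^nullity G (len-glued g v T))))
                      (trans (glued-size g v T) (trans (cong₂ _*_ kA (kernelSize≡2^nullity K (len-bordered g v T)))
                             (sym (^-distribˡ-+-* 2 (nullity A) (nullity K))))))
        nul-G : nullity G ≡ nullity H + nullity K
        nul-G = cong pred (trans suc-nul-G (cong (_+ nullity K) nul-A))
        len-G : length G ≡ (rank2 A + rank2 K) + (nullity H + nullity K)
        len-G = trans (len-glued g v T) (trans (cong₂ _+_ (trans (sym len-A) (cong (rank2 A +_) nul-A)) refl)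
                  (trans (shift (rank2 A) (nullity H) (length T))
                  (trans (cong (rank2 A + nullity H +_) (sym (trans (rank+nullity K) (len-bordered g v T))))
                         (interchange (rank2 A) (nullity H) (rank2 K) (nullity K)))))
          where
          shift : ∀ a b t → (a + suc b) + t ≡ (a + b) + suc t
          shift = solve-∀

    span-dichotomy : Spanned ⊎ Unspanned
    span-dichotomy with columnSpace-dichotomy
    ... | inj₁ (w₀ , len₀ , Aw₀≡u) = inj₁ (spanned (InSpan.bordered-size w₀ len₀ Aw₀≡u) (InSpan.glued-size w₀ len₀ Aw₀≡u))
    ... | inj₂ (s₁ , len₁ , ker∧U)  = inj₂ (unspanned (OutsideSpan.bordered-size s₁ len₁ ker∧U) (OutsideSpan.glued-size s₁ len₁ ker∧U))

module Reordering where

  open import Data.Bool using (Bool; _xor_; _∧_; not)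
  open import Data.Bool.Properties using (xor-assoc; xor-comm; ∧-assoc; ∧-comm)
  open import Data.List using (List; []; _∷_; map; length; _++_; take; drop)
  open import Data.List.Properties using (length-map; length-++; map-++; take++drop≡id)
  open import Data.Nat using (zero; suc; _+_; _^_)
  open import Data.Nat.Properties using (+-suc; +-cancelʳ-≡; suc-injective)
  open import Data.Bool.ListAction using (all)
  open import Relation.Binary.PropositionalEquality hiding ([_])
  open BoolVector using (dot; dot-++)
  open BooleanCube using ([_]; ∑𝔹; ∑𝔹-cong; insertHead; ∑𝔹-insertHead)
  open KernelCount using (inKernel; kernelSize; nullity; kernelSize≡2^nullity; rank+nullity; 2^-injective)
  open BlockMatrices using (submatrix; inKernel-map; all-cong)

  length-take-+ : ∀ p d (w : List Bool) → length w ≡ p + d → length (take p w) ≡ p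
  length-take-+ zero    d w       l = refl
  length-take-+ (suc p) d (_ ∷ w) l = cong suc (length-take-+ p d w (suc-injective l))

  all-moveToFront : ∀ {a} {V : Set a} (S₁ S₂ : List V) x (g : V → Bool) → all g (S₁ ++ x ∷ S₂) ≡ all g (x ∷ S₁ ++ S₂)
  all-moveToFront []      S₂ x g = refl
  all-moveToFront (i ∷ S₁) S₂ x g = trans (cong (g i ∧_) (all-moveToFront S₁ S₂ x g)) (swap (g i) (g x) _)
    where
    swap : ∀ a b c → a ∧ (b ∧ c) ≡ b ∧ (a ∧ c)
    swap a b c = trans (sym (∧-assoc a b c)) (trans (cong (_∧ c) (∧-comm a b)) (∧-assoc b a c))

  dot-insertHead : ∀ {a} {V : Set a} (h : V → Bool) S₁ S₂ x b w → length w ≡ length S₁ + length S₂ →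
    dot (map h (S₁ ++ x ∷ S₂)) (insertHead (length S₁) (b ∷ w)) ≡ dot (map h (x ∷ S₁ ++ S₂)) (b ∷ w)
  dot-insertHead h S₁ S₂ x b w len = begin
      dot (map h (S₁ ++ x ∷ S₂)) (take p w ++ b ∷ drop p w)
    ≡⟨ cong (λ z → dot z (take p w ++ b ∷ drop p w)) (map-++ h S₁ (x ∷ S₂)) ⟩
      dot (map h S₁ ++ h x ∷ map h S₂) (take p w ++ b ∷ drop p w)
    ≡⟨ dot-++ (map h S₁) _ (take p w) _ len-take ⟩
      P xor ((h x ∧ b) xor Q)
    ≡⟨ swap P (h x ∧ b) Q ⟩
      (h x ∧ b) xor (P xor Q)
    ≡⟨ cong ((h x ∧ b) xor_) (dot-++ (map h S₁) _ (take p w) _ len-take) ⟨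
      (h x ∧ b) xor dot (map h S₁ ++ map h S₂) (take p w ++ drop p w)
    ≡⟨ cong₂ (λ z z′ → (h x ∧ b) xor dot z z′) (sym (map-++ h S₁ S₂)) (take++drop≡id p w) ⟩
      dot (map h (x ∷ S₁ ++ S₂)) (b ∷ w)
    ∎
    where
    open ≡-Reasoning
    p = length S₁
    P = dot (map h S₁) (take p w)
    Q = dot (map h S₂) (drop p w)
    len-take : length (map h S₁) ≡ length (take p w)
    len-take = trans (length-map h S₁) (sym (length-take-+ p (length S₂) w len))
    swap : ∀ x y z → x xor (y xor z) ≡ y xor (x xor z)
    swap x y z = trans (sym (xor-assoc x y z)) (trans (cong (_xor z) (xor-comm x y)) (xor-assoc y x z))

  -- Reordering rows and columns simultaneously preserves the kernel size, hence the nullity and the rank.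
  rank-moveToFront : ∀ {a} {V : Set a} (f : V → V → Bool) S₁ S₂ x →
                     rank2 (submatrix f (S₁ ++ x ∷ S₂)) ≡ rank2 (submatrix f (x ∷ S₁ ++ S₂))
  rank-moveToFront f S₁ S₂ x =
    +-cancelʳ-≡ (nullity M₂) (rank2 M₁) (rank2 M₂)
      (trans (cong (rank2 M₁ +_) (sym nullity≡)) (trans (rank+nullity M₁) (trans len≡ (sym (rank+nullity M₂)))))
    where
    p = length S₁
    d = length S₂
    M₁ = submatrix f (S₁ ++ x ∷ S₂)
    M₂ = submatrix f (x ∷ S₁ ++ S₂)
    len₁ : length M₁ ≡ p + suc d
    len₁ = trans (length-map _ (S₁ ++ x ∷ S₂)) (length-++ S₁)
    len₂ : length M₂ ≡ suc (p + d)
    len₂ = cong suc (trans (length-map _ (S₁ ++ S₂)) (length-++ S₁))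
    len≡ : length M₁ ≡ length M₂
    len≡ = trans len₁ (trans (+-suc p d) (sym len₂))
    pointwise : ∀ w → length w ≡ suc (p + d) → [ inKernel M₁ (insertHead p w) ] ≡ [ inKernel M₂ w ]
    pointwise (b ∷ w) len = cong [_] (trans (inKernel-map _ (S₁ ++ x ∷ S₂) _)
      (trans (all-cong (S₁ ++ x ∷ S₂) (λ i → cong not (dot-insertHead (f i) S₁ S₂ x b w (suc-injective len))))
      (trans (all-moveToFront S₁ S₂ x _) (sym (inKernel-map _ (x ∷ S₁ ++ S₂) (b ∷ w))))))
    nullity≡ : nullity M₁ ≡ nullity M₂
    nullity≡ = 2^-injective _ _ (begin
      2 ^ nullity M₁                                      ≡⟨ kernelSize≡2^nullity M₁ len₁ ⟨
      kernelSize (p + suc d) M₁                            ≡⟨ ∑𝔹-insertHead p d _ ⟩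
      ∑𝔹 (suc (p + d)) (λ w → [ inKernel M₁ (insertHead p w) ]) ≡⟨ ∑𝔹-cong (suc (p + d)) pointwise ⟩
      kernelSize (suc (p + d)) M₂                          ≡⟨ kernelSize≡2^nullity M₂ len₂ ⟩
      2 ^ nullity M₂                                      ∎)
      where
      open ≡-Reasoning

module WeightedGraphs where

  open import Data.Bool using (Bool; false; _∧_)
  open import Data.Fin using (Fin; zero; suc; punchIn; toℕ; _↑ˡ_; _↑ʳ_; _≟_)
  open import Data.Fin.Properties using (splitAt-↑ˡ; splitAt-↑ʳ; punchInᵢ≢i)
  open import Data.Empty using (⊥-elim)
  open import Relation.Nullary using (yes; no)
  open import Data.List using (List; []; _∷_; map; _++_; take; drop)
  open import Data.Product using (_,_)
  open import Data.List.Properties using (map-++; map-cong; map-∘; take-map; drop-map; map-id)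
  open import Data.Nat using (ℕ; zero; suc; _+_)
  open import Relation.Binary.PropositionalEquality
  open BlockMatrices using (submatrix; bordered; glued)

  allVertices-punchIn : ∀ m (a : Fin (suc m)) → allVertices (suc m) ≡
    map (punchIn a) (take (toℕ a) (allVertices m)) ++ a ∷ map (punchIn a) (drop (toℕ a) (allVertices m))
  allVertices-punchIn m       zero    = refl
  allVertices-punchIn (suc m) (suc a) = cong (zero ∷_) (begin
      map suc (allVertices (suc m))
    ≡⟨ cong (map suc) (allVertices-punchIn m a) ⟩
      map suc (map (punchIn a) (take n L) ++ a ∷ map (punchIn a) (drop n L))
    ≡⟨ map-++ suc (map (punchIn a) (take n L)) _ ⟩
      map suc (map (punchIn a) (take n L)) ++ suc a ∷ map suc (map (punchIn a) (drop n L))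
    ≡⟨ cong₂ (λ P Q → P ++ suc a ∷ Q)
         (trans (sym (map-∘ (take n L))) (trans (map-∘ (take n L)) (cong (map (punchIn (suc a))) (sym (take-map n L)))))
         (trans (sym (map-∘ (drop n L))) (trans (map-∘ (drop n L)) (cong (map (punchIn (suc a))) (sym (drop-map n L))))) ⟩
      map (punchIn (suc a)) (take n (map suc L)) ++ suc a ∷ map (punchIn (suc a)) (drop n (map suc L))
    ∎)
    where
    open ≡-Reasoning
    L = allVertices m
    n = toℕ a

  allVertices-+ : ∀ m k → allVertices (m + k) ≡ map (_↑ˡ k) (allVertices m) ++ map (m ↑ʳ_) (allVertices k)
  allVertices-+ zero    k = sym (map-id (allVertices k))
  allVertices-+ (suc m) k = cong (zero ∷_) (begin
      map suc (allVertices (m + k))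
    ≡⟨ cong (map suc) (allVertices-+ m k) ⟩
      map suc (map (_↑ˡ k) (allVertices m) ++ map (m ↑ʳ_) (allVertices k))
    ≡⟨ map-++ suc (map (_↑ˡ k) (allVertices m)) _ ⟩
      map suc (map (_↑ˡ k) (allVertices m)) ++ map suc (map (m ↑ʳ_) (allVertices k))
    ≡⟨ cong₂ _++_ (trans (sym (map-∘ (allVertices m))) (map-∘ (allVertices m))) (sym (map-∘ (allVertices k))) ⟩
      map (_↑ˡ k) (map suc (allVertices m)) ++ map (suc m ↑ʳ_) (allVertices k)
    ∎)
    where open ≡-Reasoning

  splits-map : ∀ {a b} {V : Set a} {W : Set b} (φ : V → W) (L : List V) →
    splits (map φ L) ≡ map (λ { (S , T) → map φ S , map φ T }) (splits L)
  splits-map φ []      = refl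
  splits-map φ (v ∷ L) rewrite splits-map φ L =
    trans (cong₂ _++_ (trans (sym (map-∘ (splits L))) (map-∘ (splits L)))
                      (trans (sym (map-∘ (splits L))) (map-∘ (splits L))))
          (sym (map-++ _ (map _ (splits L)) (map _ (splits L))))

  module _ {c} {A : Set c} {m : ℕ} (H : WGraph A (suc m)) (a : Fin (suc m)) where

    column row : Fin m → Bool
    column i = adj H (punchIn a i) a
    row    i = adj H a (punchIn a i)

    inducedMatrix-delete : ∀ S → inducedMatrix H (map (punchIn a) S) ≡ submatrix (adj (delete H a)) S
    inducedMatrix-delete S = trans (sym (map-∘ S)) (map-cong (λ i → sym (map-∘ S)) S)

    inducedMatrix-column : IsGraph H → adj H a a ≡ false → ∀ S →
                           inducedMatrix H (a ∷ map (punchIn a) S) ≡ bordered (adj (delete H a)) column S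
    inducedMatrix-column H-sym a-unlooped S =
      cong₂ _∷_ (cong₂ _∷_ a-unlooped (trans (sym (map-∘ S)) (map-cong (λ j → H-sym a (punchIn a j)) S)))
                (trans (sym (map-∘ S)) (map-cong (λ i → cong (column i ∷_) (sym (map-∘ S))) S))

    inducedMatrix-row : IsGraph H → adj H a a ≡ false → ∀ S →
                        inducedMatrix H (a ∷ map (punchIn a) S) ≡ bordered (adj (delete H a)) row S
    inducedMatrix-row H-sym a-unlooped S =
      cong₂ _∷_ (cong₂ _∷_ a-unlooped (sym (map-∘ S)))
                (trans (sym (map-∘ S)) (map-cong (λ i → cong₂ _∷_ (H-sym (punchIn a i) a) (sym (map-∘ S))) S))

  module _ {c} {A : Set c} {m k : ℕ} (H : WGraph A (suc m)) (a : Fin (suc m)) (K : WGraph A (suc k)) (b : Fin (suc k)) where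

    private
      G = compose H a K b

    α-↑ˡ : ∀ i → α G (i ↑ˡ k) ≡ α H (punchIn a i)
    α-↑ˡ i rewrite splitAt-↑ˡ m i k = refl
    α-↑ʳ : ∀ j → α G (m ↑ʳ j) ≡ α K (punchIn b j)
    α-↑ʳ j rewrite splitAt-↑ʳ m k j = refl
    β-↑ˡ : ∀ i → β G (i ↑ˡ k) ≡ β H (punchIn a i)
    β-↑ˡ i rewrite splitAt-↑ˡ m i k = refl
    β-↑ʳ : ∀ j → β G (m ↑ʳ j) ≡ β K (punchIn b j)
    β-↑ʳ j rewrite splitAt-↑ʳ m k j = refl

    inducedMatrix-compose : IsGraph H → IsGraph K → ∀ S T →
      inducedMatrix G (map (_↑ˡ k) S ++ map (m ↑ʳ_) T) ≡ glued (adj (delete H a)) (column H a) (adj (delete K b)) (row K b) S T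
    inducedMatrix-compose H-sym K-sym S T =
      trans (map-++ _ (map (_↑ˡ k) S) (map (m ↑ʳ_) T))
        (cong₂ _++_ (trans (sym (map-∘ S)) (map-cong (λ i → row-of (i ↑ˡ k) (adj-↑ˡ-↑ˡ i) (adj-↑ˡ-↑ʳ i)) S))
                    (trans (sym (map-∘ T)) (map-cong (λ j → row-of (m ↑ʳ j) (adj-↑ʳ-↑ˡ j) (adj-↑ʳ-↑ʳ j)) T)))
      where
      adj-↑ˡ-↑ˡ : ∀ i i′ → adj G (i ↑ˡ k) (i′ ↑ˡ k) ≡ adj (delete H a) i i′
      adj-↑ˡ-↑ˡ i i′ rewrite splitAt-↑ˡ m i k | splitAt-↑ˡ m i′ k = refl
      adj-↑ˡ-↑ʳ : ∀ i j → adj G (i ↑ˡ k) (m ↑ʳ j) ≡ column H a i ∧ row K b j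
      adj-↑ˡ-↑ʳ i j rewrite splitAt-↑ˡ m i k | splitAt-↑ʳ m k j = refl
      adj-↑ʳ-↑ˡ : ∀ j i → adj G (m ↑ʳ j) (i ↑ˡ k) ≡ row K b j ∧ column H a i
      adj-↑ʳ-↑ˡ j i rewrite splitAt-↑ˡ m i k | splitAt-↑ʳ m k j = cong₂ _∧_ (K-sym _ _) (H-sym _ _)
      adj-↑ʳ-↑ʳ : ∀ j j′ → adj G (m ↑ʳ j) (m ↑ʳ j′) ≡ adj (delete K b) j j′
      adj-↑ʳ-↑ʳ j j′ rewrite splitAt-↑ʳ m k j | splitAt-↑ʳ m k j′ = refl
      row-of : ∀ p {h₁ : Fin m → Bool} {h₂ : Fin k → Bool} → (∀ i → adj G p (i ↑ˡ k) ≡ h₁ i) → (∀ j → adj G p (m ↑ʳ j) ≡ h₂ j) →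
               map (adj G p) (map (_↑ˡ k) S ++ map (m ↑ʳ_) T) ≡ map h₁ S ++ map h₂ T
      row-of p e₁ e₂ = trans (map-++ (adj G p) (map (_↑ˡ k) S) (map (m ↑ʳ_) T))
        (cong₂ _++_ (trans (sym (map-∘ S)) (map-cong e₁ S)) (trans (sym (map-∘ T)) (map-cong e₂ T)))

  module _ {c} {A : Set c} {n : ℕ} (W : WGraph A n) (b : Fin n) (p q : A) where

    α-setWeights-self : α (setWeights W b p q) b ≡ p
    α-setWeights-self with b ≟ b
    ... | yes _  = refl
    ... | no b≢b = ⊥-elim (b≢b refl)

    β-setWeights-self : β (setWeights W b p q) b ≡ q
    β-setWeights-self with b ≟ b
    ... | yes _  = refl
    ... | no b≢b = ⊥-elim (b≢b refl)

  module _ {c} {A : Set c} {n : ℕ} (W : WGraph A (suc n)) (b : Fin (suc n)) (p q : A) where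

    α-setWeights-punchIn : ∀ j → α (setWeights W b p q) (punchIn b j) ≡ α W (punchIn b j)
    α-setWeights-punchIn j with punchIn b j ≟ b
    ... | yes eq = ⊥-elim (punchInᵢ≢i b j eq)
    ... | no _   = refl

    β-setWeights-punchIn : ∀ j → β (setWeights W b p q) (punchIn b j) ≡ β W (punchIn b j)
    β-setWeights-punchIn j with punchIn b j ≟ b
    ... | yes eq = ⊥-elim (punchInᵢ≢i b j eq)
    ... | no _   = refl

module Expansion {c ℓ} (R : CommutativeRing c ℓ) (x y : CommutativeRing.Carrier R) where

  open CommutativeRing R
  open import Data.Fin using (Fin; punchIn; toℕ; _↑ˡ_; _↑ʳ_)
  open import Data.List using (List; []; _∷_; map; length; _++_; take; drop)
  open import Data.List.Properties using (map-++; length-++; take++drop≡id)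
  open import Data.Nat using (ℕ; zero; suc; _∸_) renaming (_+_ to _+ℕ_)
  open import Data.Nat.Properties using (+-suc)
  open import Data.Product using (_×_; _,_)
  open import Relation.Binary.PropositionalEquality as ≡ using (_≡_)
  open import Relation.Binary.Reasoning.Setoid setoid
  open ListSum commutativeSemiring
  open Reordering using (rank-moveToFront)
  open WeightedGraphs using (allVertices-punchIn; allVertices-+; splits-map)

  X Y : Carrier
  X = _⊖_ R x 1#
  Y = _⊖_ R y 1#

  -- Agrees definitionally with the summand in the definition of q.
  qTerm : ∀ {a} {V : Set a} → (V → Carrier) → (V → Carrier) → (List V → ℕ) → List V × List V → Carrier
  qTerm α′ β′ rank (S , T) =
    prodL R (map α′ S) * prodL R (map β′ T) * pow R X (rank S) * pow R Y (length S ∸ rank S)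

  sumL-map : ∀ {a} {V : Set a} (f : V → Carrier) xs → sumL R (map f xs) ≡ ∑ xs f
  sumL-map f []       = ≡.refl
  sumL-map f (v ∷ xs) = ≡.cong (f v +_) (sumL-map f xs)

  q≡∑ : ∀ {n} (W : WGraph Carrier n) → q R x y W ≡ ∑ (splits (allVertices n)) (qTerm (α W) (β W) (rankInd W))
  q≡∑ {n} W = sumL-map _ (splits (allVertices n))

  prodL-++ : ∀ (us vs : List Carrier) → prodL R (us ++ vs) ≈ prodL R us * prodL R vs
  prodL-++ []       vs = sym (*-identityˡ _)
  prodL-++ (u ∷ us) vs = trans (*-congˡ (prodL-++ us vs)) (sym (*-assoc _ _ _))

  prodL-moveToFront : ∀ {a} {V : Set a} (f : V → Carrier) S₁ S₂ v → prodL R (map f (S₁ ++ v ∷ S₂)) ≈ prodL R (map f (v ∷ S₁ ++ S₂))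
  prodL-moveToFront f []       S₂ v = refl
  prodL-moveToFront f (w ∷ S₁) S₂ v = trans (*-congˡ (prodL-moveToFront f S₁ S₂ v))
    (trans (sym (*-assoc (f w) (f v) _)) (trans (*-congʳ (*-comm (f w) (f v))) (*-assoc (f v) (f w) _)))

  pow-+ : ∀ z m n → pow R z (m +ℕ n) ≈ pow R z m * pow R z n
  pow-+ z zero    n = sym (*-identityˡ _)
  pow-+ z (suc m) n = trans (*-congˡ (pow-+ z m n)) (sym (*-assoc _ _ _))

  q-expand : ∀ {n} (W : WGraph Carrier (suc n)) (v : Fin (suc n)) →
    q R x y W ≈ ∑ (splits (allVertices n)) (λ { (S , T) →
        qTerm (α W) (β W) (rankInd W) (v ∷ map (punchIn v) S , map (punchIn v) T)
      + qTerm (α W) (β W) (rankInd W) (map (punchIn v) S , v ∷ map (punchIn v) T) })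
  q-expand {n} W v = begin
      q R x y W
    ≡⟨ q≡∑ W ⟩
      ∑ (splits (allVertices (suc n))) F
    ≡⟨ ≡.cong (λ L → ∑ (splits L) F) (allVertices-punchIn n v) ⟩
      ∑ (splits (us ++ v ∷ vs)) F
    ≈⟨ ∑-splits-moveToFront us vs v F moveˡ moveʳ ⟩
      ∑ (splits (v ∷ us ++ vs)) F
    ≡⟨ ≡.cong (λ L → ∑ (splits (v ∷ L)) F) (≡.trans (≡.sym (map-++ (punchIn v) (take (toℕ v) L) _)) (≡.cong (map (punchIn v)) (take++drop≡id (toℕ v) L))) ⟩
      ∑ (splits (v ∷ map (punchIn v) L)) F
    ≈⟨ ∑-splits-∷ v (map (punchIn v) L) F ⟩
      ∑ (splits (map (punchIn v) L)) (λ { (S , T) → F (v ∷ S , T) + F (S , v ∷ T) })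
    ≡⟨ ≡.cong (λ Z → ∑ Z (λ { (S , T) → F (v ∷ S , T) + F (S , v ∷ T) })) (splits-map (punchIn v) L) ⟩
      ∑ (map (λ { (S , T) → map (punchIn v) S , map (punchIn v) T }) (splits L)) (λ { (S , T) → F (v ∷ S , T) + F (S , v ∷ T) })
    ≡⟨ ∑-map _ (splits L) _ ⟩
      _
    ∎
    where
    F = qTerm (α W) (β W) (rankInd W)
    L = allVertices n
    us = map (punchIn v) (take (toℕ v) L)
    vs = map (punchIn v) (drop (toℕ v) L)
    moveˡ : ∀ S₁ S₂ T → F (S₁ ++ v ∷ S₂ , T) ≈ F (v ∷ S₁ ++ S₂ , T)
    moveˡ S₁ S₂ T = *-cong (*-cong (*-congʳ (prodL-moveToFront (α W) S₁ S₂ v)) (reflexive (≡.cong (pow R X) rank≡)))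
                           (reflexive (≡.cong (pow R Y) (≡.cong₂ _∸_ len≡ rank≡)))
      where
      rank≡ = rank-moveToFront (adj W) S₁ S₂ v
      len≡ : length (S₁ ++ v ∷ S₂) ≡ length (v ∷ S₁ ++ S₂)
      len≡ = ≡.trans (length-++ S₁) (≡.trans (+-suc (length S₁) (length S₂)) (≡.cong suc (≡.sym (length-++ S₁))))
    moveʳ : ∀ S T₁ T₂ → F (S , T₁ ++ v ∷ T₂) ≈ F (S , v ∷ T₁ ++ T₂)
    moveʳ S T₁ T₂ = *-congʳ (*-congʳ (*-congˡ (prodL-moveToFront (β W) T₁ T₂ v)))

  q-expand-compose : ∀ {m k} (H : WGraph Carrier (suc m)) (a : Fin (suc m)) (K : WGraph Carrier (suc k)) (b : Fin (suc k)) →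
    let G = compose H a K b in
    q R x y G ≈ ∑ (splits (allVertices m)) (λ { (S , T) → ∑ (splits (allVertices k)) (λ { (S′ , T′) →
      qTerm (α G) (β G) (rankInd G) (map (_↑ˡ k) S ++ map (m ↑ʳ_) S′ , map (_↑ˡ k) T ++ map (m ↑ʳ_) T′) }) })
  q-expand-compose {m} {k} H a K b = begin
      q R x y G
    ≡⟨ q≡∑ G ⟩
      ∑ (splits (allVertices (m +ℕ k))) F
    ≡⟨ ≡.cong (λ L → ∑ (splits L) F) (allVertices-+ m k) ⟩
      ∑ (splits (map (_↑ˡ k) (allVertices m) ++ map (m ↑ʳ_) (allVertices k))) F
    ≈⟨ ∑-splits-++ (map (_↑ˡ k) (allVertices m)) (map (m ↑ʳ_) (allVertices k)) F ⟩
      ∑ (splits (map (_↑ˡ k) (allVertices m))) (λ { (S , T) → ∑ (splits (map (m ↑ʳ_) (allVertices k))) (λ { (S′ , T′) → F (S ++ S′ , T ++ T′) }) })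
    ≡⟨ ≡.cong₂ (λ Z Z′ → ∑ Z (λ { (S , T) → ∑ Z′ (λ { (S′ , T′) → F (S ++ S′ , T ++ T′) }) }))
               (splits-map (_↑ˡ k) (allVertices m)) (splits-map (m ↑ʳ_) (allVertices k)) ⟩
      ∑ (map _ (splits (allVertices m))) (λ { (S , T) → ∑ (map _ (splits (allVertices k))) (λ { (S′ , T′) → F (S ++ S′ , T ++ T′) }) })
    ≡⟨ ∑-map _ (splits (allVertices m)) _ ⟩
      ∑ (splits (allVertices m)) (λ { (S , T) → ∑ (map _ (splits (allVertices k))) (λ { (S′ , T′) → F (map (_↑ˡ k) S ++ S′ , map (_↑ˡ k) T ++ T′) }) })
    ≈⟨ ∑-cong (splits (allVertices m)) (λ _ → reflexive (∑-map _ (splits (allVertices k)) _)) ⟩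
      _
    ∎
    where
    G = compose H a K b
    F = qTerm (α G) (β G) (rankInd G)


open BlockMatrices using (submatrix; bordered; glued)
open BoolVector using (Symmetric; ZeroDiagonal)
open KernelCount using (nullity)
open SpanCases using (Spanned; Unspanned; span-dichotomy)
open WeightedGraphs

module _ {c ℓ} (R : CommutativeRing c ℓ) (x y : CommutativeRing.Carrier R) where

  open CommutativeRing R
  open import Relation.Binary.Reasoning.Setoid setoid
  open import Algebra.Properties.Ring ring using (-‿distribʳ-*)
  open import Algebra.Solver.Ring.NaturalCoefficients.Default commutativeSemiring
  open ListSum commutativeSemiring
  open Expansion R x y

  monomial : ℕ → ℕ → Carrier
  monomial r n = pow R X r * pow R Y n

  rankMonomial : List (List Bool) → Carrier
  rankMonomial M = monomial (rank2 M) (nullity M)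

  weight : ∀ {a} {V : Set a} → (V → Carrier) → (V → Carrier) → List V × List V → Carrier
  weight α′ β′ (S , T) = prodL R (map α′ S) * prodL R (map β′ T)

  qTerm-inducedMatrix : ∀ {n} (W : WGraph Carrier n) S T {A B} M →
    prodL R (map (α W) S) ≈ A → prodL R (map (β W) T) ≈ B → inducedMatrix W S ≡ M →
    qTerm (α W) (β W) (rankInd W) (S , T) ≈ (A * B) * rankMonomial M
  qTerm-inducedMatrix W S T M eA eB ≡.refl =
    trans (*-assoc _ _ _) (*-cong (*-cong eA eB) (*-congˡ (reflexive (≡.cong (λ l → pow R Y (l ∸ rankInd W S)) (≡.sym (length-map _ S))))))

  prodL-map-∘ : ∀ {a b} {V : Set a} {W : Set b} (f : W → Carrier) (φ : V → W) S →
                prodL R (map f (map φ S)) ≈ prodL R (map (λ i → f (φ i)) S)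
  prodL-map-∘ f φ S = reflexive (≡.cong (prodL R) (≡.sym (map-∘ S)))

  y≈Y+1 : y ≈ Y + 1#
  y≈Y+1 = sym (trans (+-assoc y (- 1#) 1#) (trans (+-congˡ (-‿inverseˡ 1#)) (+-identityʳ y)))

  move-terms : ∀ z p q w → z + p ≈ q + w → z + - w ≈ q + - p
  move-terms z p q w eq = begin
      z + - w                    ≈⟨ sym (+-identityʳ _) ⟩
      (z + - w) + 0#             ≈⟨ +-congˡ (sym (-‿inverseʳ p)) ⟩
      (z + - w) + (p + - p)      ≈⟨ solve 4 (λ z nw p np → (z :+ nw) :+ (p :+ np) := (z :+ p) :+ (nw :+ np)) refl z (- w) p (- p) ⟩
      (z + p) + (- w + - p)      ≈⟨ +-congʳ eq ⟩
      (q + w) + (- w + - p)      ≈⟨ solve 4 (λ q w nw np → (q :+ w) :+ (nw :+ np) := q :+ ((w :+ nw) :+ np)) refl q w (- w) (- p) ⟩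
      q + ((w + - w) + - p)      ≈⟨ +-congˡ (+-congʳ (-‿inverseʳ w)) ⟩
      q + (0# + - p)             ≈⟨ +-congˡ (+-identityˡ _) ⟩
      q + - p                    ∎

  cancel-X²-Y² : ∀ d z → d * (pow R X 2 + - pow R Y 2) ≈ 1# → (z * pow R X 2 + - (z * pow R Y 2)) * d ≈ z
  cancel-X²-Y² d z d-inv = begin
      (z * pow R X 2 + - (z * pow R Y 2)) * d   ≈⟨ *-congʳ (+-congˡ (-‿distribʳ-* z (pow R Y 2))) ⟩
      (z * pow R X 2 + z * - pow R Y 2) * d     ≈⟨ *-congʳ (sym (distribˡ z _ _)) ⟩
      (z * (pow R X 2 + - pow R Y 2)) * d       ≈⟨ *-assoc z _ d ⟩
      z * ((pow R X 2 + - pow R Y 2) * d)       ≈⟨ *-congˡ (trans (*-comm _ d) d-inv) ⟩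
      z * 1#                                    ≈⟨ *-identityʳ z ⟩
      z                                         ∎

  -- Solving  q(H - a) = A₁ + Y A₂,  q(H) = y A₁ + (Y + X²) A₂  for A₁ and A₂; the determinant is X² - Y².
  solve-A₂ : ∀ d A₁ A₂ qH qH-a → d * (pow R X 2 + - pow R Y 2) ≈ 1# →
             qH-a ≈ A₁ + Y * A₂ → qH ≈ y * A₁ + (Y + pow R X 2) * A₂ → (qH + - (y * qH-a)) * d ≈ A₂
  solve-A₂ d A₁ A₂ qH qH-a d-inv qH-a≈ qH≈ =
    trans (*-congʳ (move-terms qH (A₂ * pow R Y 2) (A₂ * pow R X 2) (y * qH-a) eq)) (cancel-X²-Y² d A₂ d-inv)
    where
    eq : qH + A₂ * pow R Y 2 ≈ A₂ * pow R X 2 + y * qH-a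
    eq = trans (+-congʳ (trans qH≈ (+-congʳ (*-congʳ y≈Y+1))))
           (trans (solve 4 (λ yy xx a₁ a₂ → (yy :+ con 1) :* a₁ :+ (yy :+ xx :* (xx :* con 1)) :* a₂ :+ a₂ :* (yy :* (yy :* con 1))
                                            := a₂ :* (xx :* (xx :* con 1)) :+ (yy :+ con 1) :* (a₁ :+ yy :* a₂)) refl Y X A₁ A₂)
                  (sym (+-congˡ (*-cong y≈Y+1 qH-a≈))))

  solve-A₁ : ∀ d A₁ A₂ qH qH-a → d * (pow R X 2 + - pow R Y 2) ≈ 1# →
             qH-a ≈ A₁ + Y * A₂ → qH ≈ y * A₁ + (Y + pow R X 2) * A₂ → ((pow R X 2 + Y) * qH-a + - (Y * qH)) * d ≈ A₁
  solve-A₁ d A₁ A₂ qH qH-a d-inv qH-a≈ qH≈ =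
    trans (*-congʳ (move-terms ((pow R X 2 + Y) * qH-a) (A₁ * pow R Y 2) (A₁ * pow R X 2) (Y * qH) eq)) (cancel-X²-Y² d A₁ d-inv)
    where
    eq : (pow R X 2 + Y) * qH-a + A₁ * pow R Y 2 ≈ A₁ * pow R X 2 + Y * qH
    eq = trans (+-congʳ (*-congˡ qH-a≈))
           (trans (solve 4 (λ yy xx a₁ a₂ → (xx :* (xx :* con 1) :+ yy) :* (a₁ :+ yy :* a₂) :+ a₁ :* (yy :* (yy :* con 1))
                                            := a₁ :* (xx :* (xx :* con 1)) :+ yy :* ((yy :+ con 1) :* a₁ :+ (yy :+ xx :* (xx :* con 1)) :* a₂)) refl Y X A₁ A₂)
                  (sym (+-congˡ (*-congˡ (trans qH≈ (+-congʳ (*-congʳ y≈Y+1)))))))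

  module _ {a b} {I : Set a} {J : Set b} (f : I → I → Bool) (f-sym : Symmetric f) (f-diag : ZeroDiagonal f)
           (u : I → Bool) (S : List I) where

    private
      A = submatrix f S
      H = bordered f u S
      SpanCase = Spanned {J = J} f f-sym f-diag u S ⊎ Unspanned {J = J} f f-sym f-diag u S

    spannedPart : SpanCase → Carrier
    spannedPart (inj₁ _) = rankMonomial A
    spannedPart (inj₂ _) = 0#

    unspannedPart : SpanCase → Carrier
    unspannedPart (inj₁ _) = 0#
    unspannedPart (inj₂ _) = monomial (rank2 A) (nullity H)

    rankMonomial-submatrix : ∀ case → rankMonomial A ≈ spannedPart case + Y * unspannedPart case
    rankMonomial-submatrix (inj₁ _) = trans (sym (+-identityʳ _)) (+-congˡ (sym (zeroʳ Y)))
    rankMonomial-submatrix (inj₂ (_ , nul-A , _)) = trans (reflexive (≡.cong (monomial (rank2 A)) nul-A))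
      (solve 3 (λ p yy q → p :* (yy :* q) := con 0 :+ yy :* (p :* q)) refl (pow R X (rank2 A)) Y (pow R Y (nullity H)))

    rankMonomial-bordered : ∀ case → rankMonomial H + rankMonomial A ≈ y * spannedPart case + (Y + pow R X 2) * unspannedPart case
    rankMonomial-bordered (inj₁ (rank-H , nul-H , _)) =
      trans (+-congʳ (reflexive (≡.cong₂ monomial rank-H nul-H)))
        (trans (solve 4 (λ p yy q z → p :* (yy :* q) :+ p :* q := (yy :+ con 1) :* (p :* q) :+ z :* con 0) refl
                        (pow R X (rank2 A)) Y (pow R Y (nullity A)) (Y + pow R X 2))
               (+-congʳ (*-congʳ (sym y≈Y+1))))
    rankMonomial-bordered (inj₂ (rank-H , nul-A , _)) =
      trans (+-cong (reflexive (≡.cong (λ r → monomial r (nullity H)) rank-H)) (reflexive (≡.cong (monomial (rank2 A)) nul-A)))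
        (solve 5 (λ xx yy yv p q → xx :* (xx :* p) :* q :+ p :* (yy :* q) := yv :* con 0 :+ (yy :+ xx :* (xx :* con 1)) :* (p :* q)) refl
               X Y y (pow R X (rank2 A)) (pow R Y (nullity H)))

    rankMonomial-glued : ∀ case g v (T : List J) →
      rankMonomial (glued f u g v S T) ≈ spannedPart case * rankMonomial (submatrix g T) + unspannedPart case * rankMonomial (bordered g v T)
    rankMonomial-glued (inj₁ (_ , _ , glued-ranks)) g v T =
      trans (reflexive (≡.cong₂ monomial (proj₁ (glued-ranks g v T)) (proj₂ (glued-ranks g v T))))
        (trans (*-cong (pow-+ X (rank2 A) (rank2 B)) (pow-+ Y (nullity A) (nullity B)))
          (solve 5 (λ a₁ a₂ b₁ b₂ z → (a₁ :* a₂) :* (b₁ :* b₂) := (a₁ :* b₁) :* (a₂ :* b₂) :+ con 0 :* z) refl _ _ _ _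
                 (rankMonomial (bordered g v T))))
      where B = submatrix g T
    rankMonomial-glued (inj₂ (_ , _ , glued-ranks)) g v T =
      trans (reflexive (≡.cong₂ monomial (proj₁ (glued-ranks g v T)) (proj₂ (glued-ranks g v T))))
        (trans (*-cong (pow-+ X (rank2 A) (rank2 K)) (pow-+ Y (nullity H) (nullity K)))
          (solve 5 (λ a₁ a₂ b₁ b₂ z → (a₁ :* a₂) :* (b₁ :* b₂) := con 0 :* z :+ (a₁ :* b₁) :* (a₂ :* b₂)) refl _ _ _ _
                 (rankMonomial (submatrix g T))))
      where K = bordered g v T

  module Decomposition {m k : ℕ} (H : WGraph Carrier (suc m)) (a : Fin (suc m))
                       (H-sym : IsGraph H) (H-loopless : Loopless H) (α-a : α H a ≈ 1#) (β-a : β H a ≈ 1#)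
                       (K : WGraph Carrier (suc k)) (b : Fin (suc k)) (K-sym : IsGraph K) (b-unlooped : adj K b b ≡ false) where

    private
      f = adj (delete H a)
      u = column H a
      g = adj (delete K b)
      v = row K b
      wH : List (Fin m) × List (Fin m) → Carrier
      wH = weight (α (delete H a)) (β (delete H a))
      wK : List (Fin k) × List (Fin k) → Carrier
      wK = weight (α (delete K b)) (β (delete K b))
      f-sym : Symmetric f
      f-sym i j = H-sym (punchIn a i) (punchIn a j)
      f-diag : ZeroDiagonal f
      f-diag i = H-loopless (punchIn a i)

    spanCase : ∀ S → Spanned {J = Fin k} f f-sym f-diag u S ⊎ Unspanned {J = Fin k} f f-sym f-diag u S
    spanCase S = span-dichotomy f f-sym f-diag u S

    σ τ : List (Fin m) → Carrier
    σ S = spannedPart f f-sym f-diag u S (spanCase S)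
    τ S = unspannedPart f f-sym f-diag u S (spanCase S)

    A₁ A₂ : Carrier
    A₁ = ∑ (splits (allVertices m)) (λ { (S , T) → wH (S , T) * σ S })
    A₂ = ∑ (splits (allVertices m)) (λ { (S , T) → wH (S , T) * τ S })

    qTerm-delete : ∀ S T → qTerm (α (delete H a)) (β (delete H a)) (rankInd (delete H a)) (S , T) ≈ wH (S , T) * rankMonomial (submatrix f S)
    qTerm-delete S T = qTerm-inducedMatrix (delete H a) S T (submatrix f S) refl refl ≡.refl

    qTerm-with-a : ∀ S T → qTerm (α H) (β H) (rankInd H) (a ∷ map (punchIn a) S , map (punchIn a) T) ≈ wH (S , T) * rankMonomial (bordered f u S)
    qTerm-with-a S T = qTerm-inducedMatrix H _ (map (punchIn a) T) (bordered f u S)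
      (trans (*-congʳ α-a) (trans (*-identityˡ _) (prodL-map-∘ (α H) (punchIn a) S))) (prodL-map-∘ (β H) (punchIn a) T)
      (inducedMatrix-column H a H-sym (H-loopless a) S)

    qTerm-without-a : ∀ S T → qTerm (α H) (β H) (rankInd H) (map (punchIn a) S , a ∷ map (punchIn a) T) ≈ wH (S , T) * rankMonomial (submatrix f S)
    qTerm-without-a S T = qTerm-inducedMatrix H (map (punchIn a) S) (a ∷ map (punchIn a) T) (submatrix f S)
      (prodL-map-∘ (α H) (punchIn a) S) (trans (*-congʳ β-a) (trans (*-identityˡ _) (prodL-map-∘ (β H) (punchIn a) T)))
      (inducedMatrix-delete H a S)

    q-delete≈ : q R x y (delete H a) ≈ A₁ + Y * A₂
    q-delete≈ = begin
        q R x y (delete H a)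
      ≡⟨ q≡∑ (delete H a) ⟩
        ∑ (splits (allVertices m)) (qTerm (α (delete H a)) (β (delete H a)) (rankInd (delete H a)))
      ≈⟨ ∑-cong (splits (allVertices m)) (λ { (S , T) → trans (qTerm-delete S T) (trans (*-congˡ (rankMonomial-submatrix f f-sym f-diag u S (spanCase S)))
            (solve 4 (λ w s yy t → w :* (s :+ yy :* t) := w :* s :+ yy :* (w :* t)) refl (wH (S , T)) (σ S) Y (τ S))) }) ⟩
        ∑ (splits (allVertices m)) (λ { (S , T) → wH (S , T) * σ S + Y * (wH (S , T) * τ S) })
      ≈⟨ ∑-+ (splits (allVertices m)) _ _ ⟩
        A₁ + ∑ (splits (allVertices m)) (λ { (S , T) → Y * (wH (S , T) * τ S) })
      ≈⟨ +-congˡ (∑-*ˡ (splits (allVertices m)) Y _) ⟩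
        A₁ + Y * A₂
      ∎

    q-H≈ : q R x y H ≈ y * A₁ + (Y + pow R X 2) * A₂
    q-H≈ = begin
        q R x y H
      ≈⟨ q-expand H a ⟩
        ∑ (splits (allVertices m)) (λ { (S , T) →
            qTerm (α H) (β H) (rankInd H) (a ∷ map (punchIn a) S , map (punchIn a) T)
          + qTerm (α H) (β H) (rankInd H) (map (punchIn a) S , a ∷ map (punchIn a) T) })
      ≈⟨ ∑-cong (splits (allVertices m)) (λ { (S , T) →
           trans (+-cong (qTerm-with-a S T) (qTerm-without-a S T)) (trans (sym (distribˡ (wH (S , T)) _ _))
           (trans (*-congˡ (rankMonomial-bordered f f-sym f-diag u S (spanCase S)))
           (solve 5 (λ w yv s z t → w :* (yv :* s :+ z :* t) := yv :* (w :* s) :+ z :* (w :* t)) refl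
                  (wH (S , T)) y (σ S) (Y + pow R X 2) (τ S)))) }) ⟩
        ∑ (splits (allVertices m)) (λ { (S , T) → y * (wH (S , T) * σ S) + (Y + pow R X 2) * (wH (S , T) * τ S) })
      ≈⟨ ∑-+ (splits (allVertices m)) _ _ ⟩
        ∑ (splits (allVertices m)) (λ { (S , T) → y * (wH (S , T) * σ S) })
          + ∑ (splits (allVertices m)) (λ { (S , T) → (Y + pow R X 2) * (wH (S , T) * τ S) })
      ≈⟨ +-cong (∑-*ˡ (splits (allVertices m)) y _) (∑-*ˡ (splits (allVertices m)) (Y + pow R X 2) _) ⟩
        y * A₁ + (Y + pow R X 2) * A₂
      ∎

    private
      G = compose H a K b
      P Q : List (Fin k) → Carrier
      P T = rankMonomial (submatrix g T)
      Q T = rankMonomial (bordered g v T)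

    qTerm-compose : ∀ S T S′ T′ →
      qTerm (α G) (β G) (rankInd G) (map (_↑ˡ k) S ++ map (m ↑ʳ_) S′ , map (_↑ˡ k) T ++ map (m ↑ʳ_) T′)
        ≈ (wH (S , T) * wK (S′ , T′)) * rankMonomial (glued f u g v S S′)
    qTerm-compose S T S′ T′ =
      trans (qTerm-inducedMatrix G _ (map (_↑ˡ k) T ++ map (m ↑ʳ_) T′) (glued f u g v S S′)
               (prodL-split (α G) (α-↑ˡ H a K b) (α-↑ʳ H a K b) S S′) (prodL-split (β G) (β-↑ˡ H a K b) (β-↑ʳ H a K b) T T′)
               (inducedMatrix-compose H a K b H-sym K-sym S S′))
            (*-congʳ (solve 4 (λ p q r s → (p :* q) :* (r :* s) := (p :* r) :* (q :* s)) refl _ _ _ _))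
      where
      prodL-split : ∀ (w : Fin (m +ℕ k) → Carrier) {w₁ : Fin m → Carrier} {w₂ : Fin k → Carrier} →
                    (∀ i → w (i ↑ˡ k) ≡ w₁ i) → (∀ j → w (m ↑ʳ j) ≡ w₂ j) → ∀ S S′ →
                    prodL R (map w (map (_↑ˡ k) S ++ map (m ↑ʳ_) S′)) ≈ prodL R (map w₁ S) * prodL R (map w₂ S′)
      prodL-split w e₁ e₂ S S′ = trans (reflexive (≡.cong (prodL R) (map-++ w (map (_↑ˡ k) S) (map (m ↑ʳ_) S′))))
        (trans (prodL-++ (map w (map (_↑ˡ k) S)) (map w (map (m ↑ʳ_) S′)))
               (*-cong (reflexive (≡.cong (prodL R) (≡.trans (≡.sym (map-∘ S)) (map-cong e₁ S))))
                       (reflexive (≡.cong (prodL R) (≡.trans (≡.sym (map-∘ S′)) (map-cong e₂ S′))))))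

    q-compose≈ : q R x y G ≈ ∑ (splits (allVertices k)) (λ { (S′ , T′) → wK (S′ , T′) * (A₁ * P S′ + A₂ * Q S′) })
    q-compose≈ = begin
        q R x y G
      ≈⟨ q-expand-compose H a K b ⟩
        ∑ (splits (allVertices m)) (λ { (S , T) → ∑ (splits (allVertices k)) (λ { (S′ , T′) →
          qTerm (α G) (β G) (rankInd G) (map (_↑ˡ k) S ++ map (m ↑ʳ_) S′ , map (_↑ˡ k) T ++ map (m ↑ʳ_) T′) }) })
      ≈⟨ ∑-cong (splits (allVertices m)) (λ { (S , T) → ∑-cong (splits (allVertices k)) (λ { (S′ , T′) →
           trans (qTerm-compose S T S′ T′) (trans (*-congˡ (rankMonomial-glued f f-sym f-diag u S (spanCase S) g v S′))
           (solve 6 (λ wh wk s p t q → (wh :* wk) :* (s :* p :+ t :* q) := wk :* ((wh :* s) :* p :+ (wh :* t) :* q)) refl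
                  (wH (S , T)) (wK (S′ , T′)) (σ S) (P S′) (τ S) (Q S′))) }) }) ⟩
        ∑ (splits (allVertices m)) (λ { (S , T) → ∑ (splits (allVertices k)) (λ { (S′ , T′) →
          wK (S′ , T′) * ((wH (S , T) * σ S) * P S′ + (wH (S , T) * τ S) * Q S′) }) })
      ≈⟨ ∑-comm (splits (allVertices m)) (splits (allVertices k)) _ ⟩
        ∑ (splits (allVertices k)) (λ { (S′ , T′) → ∑ (splits (allVertices m)) (λ { (S , T) →
          wK (S′ , T′) * ((wH (S , T) * σ S) * P S′ + (wH (S , T) * τ S) * Q S′) }) })
      ≈⟨ ∑-cong (splits (allVertices k)) (λ { (S′ , T′) → trans (∑-*ˡ (splits (allVertices m)) (wK (S′ , T′)) _)
           (*-congˡ (trans (∑-+ (splits (allVertices m)) _ _)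
                    (+-cong (∑-*ʳ (splits (allVertices m)) (P S′) _) (∑-*ʳ (splits (allVertices m)) (Q S′) _)))) }) ⟩
        ∑ (splits (allVertices k)) (λ { (S′ , T′) → wK (S′ , T′) * (A₁ * P S′ + A₂ * Q S′) })
      ∎

    module _ (α′ β′ : Carrier) where

      private
        K′ = setWeights K b α′ β′

      qTerm-K′ : ∀ S T → qTerm (α K′) (β K′) (rankInd K′) (b ∷ map (punchIn b) S , map (punchIn b) T)
                       + qTerm (α K′) (β K′) (rankInd K′) (map (punchIn b) S , b ∷ map (punchIn b) T)
                       ≈ α′ * (wK (S , T) * Q S) + β′ * (wK (S , T) * P S)
      qTerm-K′ S T = +-cong
        (trans (qTerm-inducedMatrix K′ _ (map (punchIn b) T) (bordered g v S)
                  (*-cong (reflexive (α-setWeights-self K b α′ β′)) (prodL-K′ α (α-setWeights-punchIn K b α′ β′) S)) (prodL-K′ β (β-setWeights-punchIn K b α′ β′) T)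
                  (inducedMatrix-row K b K-sym b-unlooped S))
               (trans (*-congʳ (*-assoc α′ _ _)) (*-assoc α′ _ _)))
        (trans (qTerm-inducedMatrix K′ (map (punchIn b) S) (b ∷ map (punchIn b) T) (submatrix g S)
                  (prodL-K′ α (α-setWeights-punchIn K b α′ β′) S) (*-cong (reflexive (β-setWeights-self K b α′ β′)) (prodL-K′ β (β-setWeights-punchIn K b α′ β′) T))
                  (inducedMatrix-delete K b S))
               (solve 4 (λ p q r s → (p :* (q :* r)) :* s := q :* ((p :* r) :* s)) refl _ β′ _ _))
        where
        prodL-K′ : ∀ (w : WGraph Carrier (suc k) → Fin (suc k) → Carrier) → (∀ j → w K′ (punchIn b j) ≡ w K (punchIn b j)) → ∀ S →
                   prodL R (map (w K′) (map (punchIn b) S)) ≈ prodL R (map (λ j → w K (punchIn b j)) S)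
        prodL-K′ w e S = reflexive (≡.cong (prodL R) (≡.trans (≡.sym (map-∘ S)) (map-cong e S)))

      q-setWeights≈ : q R x y K′ ≈ ∑ (splits (allVertices k)) (λ { (S , T) → α′ * (wK (S , T) * Q S) + β′ * (wK (S , T) * P S) })
      q-setWeights≈ = trans (q-expand K′ b) (∑-cong (splits (allVertices k)) (λ { (S , T) → qTerm-K′ S T }))

      q-compose≈q-setWeights : α′ ≈ A₂ → β′ ≈ A₁ → q R x y G ≈ q R x y K′
      q-compose≈q-setWeights α′≈A₂ β′≈A₁ = trans q-compose≈ (sym (trans q-setWeights≈ (∑-cong (splits (allVertices k)) (λ { (S , T) →
        trans (+-cong (*-congʳ α′≈A₂) (*-congʳ β′≈A₁))
          (solve 5 (λ a₂ w q a₁ p → a₂ :* (w :* q) :+ a₁ :* (w :* p) := w :* (a₁ :* p :+ a₂ :* q)) refl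
                 A₂ (wK (S , T)) (Q S) A₁ (P S)) }))))

theorem8 : {c ℓ : Level} (R : CommutativeRing c ℓ) →
    let open CommutativeRing R in
    (x y : Carrier) →
    (d : Carrier) →
    d * (pow R (_⊖_ R x 1#) 2 + - pow R (_⊖_ R y 1#) 2) ≈ 1# →
    {m k : ℕ} →
    (H : WGraph Carrier (suc m)) → (a : Fin (suc m)) →
    IsGraph H → Loopless H → α H a ≈ 1# → β H a ≈ 1# →
    (K : WGraph Carrier (suc k)) → (b : Fin (suc k)) →
    IsGraph K → adj K b b ≡ false → α K b ≈ 1# → β K b ≈ 1# →
    q R x y (compose H a K b)
      ≈ q R x y (setWeights K b
          ((q R x y H + - (y * q R x y (delete H a))) * d)
          (((pow R (_⊖_ R x 1#) 2 + _⊖_ R y 1#) * q R x y (delete H a)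
             + - (_⊖_ R y 1# * q R x y H)) * d))
-- The weights of b in K are irrelevant: setWeights replaces them.
theorem8 R x y d d-inv H a H-sym H-loopless α-a β-a K b K-sym b-unlooped _ _ =
  q-compose≈q-setWeights _ _
    (solve-A₂ R x y d A₁ A₂ (q R x y H) (q R x y (delete H a)) d-inv q-delete≈ q-H≈)
    (solve-A₁ R x y d A₁ A₂ (q R x y H) (q R x y (delete H a)) d-inv q-delete≈ q-H≈)
  where open Decomposition R x y H a H-sym H-loopless α-a β-a K b K-sym b-unlooped
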